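{- Let $A=\mathbb{F}_q[t]$, where $q$ is a power of a prime $p$, let $d>1$ be an integer and let $c\in\mathbb{F}_q^*$. If $L_{d-1}+c$ and $[d]$ have a non-trivial greatest common divisor in $A$, then $p$ divides $d$.
   Context: For $n\ge 0$, $[n]:=t^{q^n}-t$. $L_0=1$ and $L_n=[n]L_{n-1}$ for $n\ge1$, so $L_{d-1}=[1][2]\cdots[d-1]$. -}

module Defs where

open import Level using (0ℓ)
open import Algebra.Bundles using (CommutativeRing)
open import Data.Nat as ℕ using (ℕ; zero; suc)
open import Data.Fin using (Fin)
open import Data.List using (List; []; _∷_; map)
open import Data.Product using (∃; _×_)
open import Relation.Nullary using (¬_)
open import Relation.Binary.Definitions using (Decidable)
open import Relation.Binary.PropositionalEquality using (_≡_)

record IsFiniteField (R : CommutativeRing 0ℓ 0ℓ) (q : ℕ) : Set where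
  open CommutativeRing R
  field
    _≟_      : Decidable _≈_
    1≉0      : ¬ (1# ≈ 0#)
    inverse  : ∀ x → ¬ (x ≈ 0#) → ∃ λ y → x * y ≈ 1#
    enum     : Fin q → Carrier
    enum-surj : ∀ x → ∃ λ i → enum i ≈ x
    enum-inj  : ∀ i j → enum i ≈ enum j → i ≡ j

-- Polynomials in one variable t over a commutative ring R, as coefficient
-- lists (constant coefficient first).
module Poly (R : CommutativeRing 0ℓ 0ℓ) where
  open CommutativeRing R

  ntimes : ℕ → Carrier → Carrier
  ntimes zero x = 0#
  ntimes (suc n) x = x + ntimes n x

  Pol : Set
  Pol = List Carrier

  coeff : Pol → ℕ → Carrier
  coeff [] n = 0#
  coeff (a ∷ f) zero = a
  coeff (a ∷ f) (suc n) = coeff f n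

  _≈ₚ_ : Pol → Pol → Set
  f ≈ₚ g = ∀ n → coeff f n ≈ coeff g n

  _+ₚ_ : Pol → Pol → Pol
  [] +ₚ g = g
  (a ∷ f) +ₚ [] = a ∷ f
  (a ∷ f) +ₚ (b ∷ g) = (a + b) ∷ (f +ₚ g)

  -ₚ_ : Pol → Pol
  -ₚ f = map -_ f

  _-ₚ_ : Pol → Pol → Pol
  f -ₚ g = f +ₚ (-ₚ g)

  scale : Carrier → Pol → Pol
  scale a g = map (a *_) g

  _*ₚ_ : Pol → Pol → Pol
  [] *ₚ g = []
  (a ∷ f) *ₚ g = scale a g +ₚ (0# ∷ (f *ₚ g))

  const : Carrier → Pol
  const a = a ∷ []

  oneₚ : Pol
  oneₚ = const 1#

  T : Pol
  T = 0# ∷ 1# ∷ []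

  _^ₚ_ : Pol → ℕ → Pol
  f ^ₚ zero = oneₚ
  f ^ₚ suc n = f *ₚ (f ^ₚ n)

  _∣ₚ_ : Pol → Pol → Set
  f ∣ₚ g = ∃ λ h → g ≈ₚ (f *ₚ h)

  IsUnitₚ : Pol → Set
  IsUnitₚ f = ∃ λ h → (f *ₚ h) ≈ₚ oneₚ

  NontrivialGcd : Pol → Pol → Set
  NontrivialGcd f g = ∃ λ h → (h ∣ₚ f) × (h ∣ₚ g) × ¬ IsUnitₚ h

  bracket : ℕ → ℕ → Pol
  bracket q n = (T ^ₚ (q ℕ.^ n)) -ₚ T

  L : ℕ → ℕ → Pol
  L q zero = oneₚ
  L q (suc n) = bracket q (suc n) *ₚ L q n

-- Let h be a common non-unit divisor and work in B = A/(h), a nonzero ring of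
-- characteristic p in which Fr(x) = x^q is a ring endomorphism fixing the constants
-- (Fermat). Put θᵢ = t^(qⁱ), so that Fr θᵢ = θᵢ₊₁ and [n] = θₙ - θ₀. In B we have
-- θ_d = θ₀, so θ is d-periodic, and L_{d-1} = -c. Applying Frⁱ to
-- L_{d-1} = ∏_{0<j<d} (θⱼ - θ₀) gives Dᵢ = ∏_{i<j<i+d} (θⱼ - θᵢ) = -c for every i.
-- Hence the differences θⱼ - θᵢ (i ≠ j < d) are units and, by periodicity,
-- ∏_{j<d, j≠i} (θⱼ - θᵢ)⁻¹ = Dᵢ⁻¹ = (-c)⁻¹ for each i. The partial fraction identity
-- Σᵢ ∏_{j≠i} (θⱼ - θᵢ)⁻¹ = 0, valid for d ≥ 2 points, then says d · (-c)⁻¹ = 0.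
-- So d = 0 in B, hence in 𝔽_q, and p ∣ d.

module Submission where

open import Defs
open import Level using (0ℓ)
open import Algebra.Bundles using (CommutativeRing)
open import Data.Nat using (ℕ; _^_; _∸_; _<_)
open import Data.Nat.Divisibility using (_∣_)
open import Data.Nat.Primality using (Prime)
open import Data.Product using (∃)
open import Relation.Nullary using (¬_)
open import Relation.Binary.PropositionalEquality using (_≡_)

open import Algebra.Core using (Op₁; Op₂)
import Algebra.Properties.Ring
import Algebra.Properties.Semiring.Exp as Exp
open import Data.Fin using (Fin; zero; suc; toℕ; fromℕ; inject₁; punchIn)
open import Data.Fin.Permutation using (Permutation′; permutation)
open import Data.Fin.Properties using (toℕ-fromℕ; toℕ-inject₁; toℕ<n; punchInᵢ≢i)
open import Data.List using (List; []; _∷_; _++_; map)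
open import Data.List.Relation.Unary.All as All using (All; []; _∷_)
open import Data.List.Relation.Unary.AllPairs using (AllPairs; []; _∷_)
open import Data.Nat as ℕ using (zero; suc)
open import Data.Nat.Combinatorics using (_C_; nCn≡1; nC1≡n; nCk+nC[k+1]≡[n+1]C[k+1])
open import Data.Nat.Coprimality using (Coprime; coprime-Bézout)
open import Data.Nat.Divisibility using (divides; >⇒∤; m∣m*n; _∣?_)
open import Data.Nat.GCD using (module Bézout)
open import Data.Nat.Primality using (euclidsLemma; prime⇒irreducible)
import Data.Nat.Properties as ℕₚ
open import Data.Nat.Solver using (module +-*-Solver)
open import Data.Product using (_,_; proj₁; proj₂)
open import Data.Sum using (inj₁; inj₂)
open import Data.Vec.Functional using (init; removeAt; replicate)
open import Function using (flip; _∘_)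
open import Relation.Binary using (Rel; IsEquivalence; Setoid)
import Relation.Binary.PropositionalEquality as ≡
open import Relation.Binary.PropositionalEquality using (_≢_)
import Relation.Binary.Reasoning.Setoid
open import Relation.Nullary using (contradiction; yes; no)

module RingLemmas (S : CommutativeRing 0ℓ 0ℓ) where
  open CommutativeRing S
  open import Algebra.Properties.Ring ring using (-‿+-comm; x[y-z]≈xy-xz; [y-z]x≈yx-zx)
  open import Algebra.Properties.CommutativeSemigroup +-commutativeSemigroup using (interchange)
  open import Relation.Binary.Reasoning.Setoid setoid

  telescope : ∀ x y z → (x - y) + (y - z) ≈ x - z
  telescope x y z = begin
    (x - y) + (y - z)   ≈⟨ +-assoc x (- y) (y - z) ⟩
    x + (- y + (y - z)) ≈⟨ +-congˡ (+-assoc (- y) y (- z)) ⟨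
    x + ((- y + y) - z) ≈⟨ +-congˡ (+-congʳ (-‿inverseˡ y)) ⟩
    x + (0# - z)        ≈⟨ +-congˡ (+-identityˡ (- z)) ⟩
    x - z               ∎

  +-minus-+ : ∀ x y u v → (x + u) - (y + v) ≈ (x - y) + (u - v)
  +-minus-+ x y u v = trans (+-congˡ (sym (-‿+-comm y v))) (interchange x u (- y) (- v))

  *-minus-* : ∀ x y u v → x * u - y * v ≈ (x - y) * u + y * (u - v)
  *-minus-* x y u v = begin
    x * u - y * v                     ≈⟨ telescope (x * u) (y * u) (y * v) ⟨
    (x * u - y * u) + (y * u - y * v) ≈⟨ +-cong ([y-z]x≈yx-zx u x y) (x[y-z]≈xy-xz y u v) ⟨
    (x - y) * u + y * (u - v)         ∎

module _ {A : Set} (_≈_ : Rel A 0ℓ) where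
  open import Algebra.Definitions _≈_
  open import Algebra.Structures _≈_ using (IsCommutativeRing)

  record IsCommutativeRingˡ (_+_ _*_ : Op₂ A) (-_ : Op₁ A) (0# 1# : A) : Set where
    field
      isEquivalence : IsEquivalence _≈_
      +-cong        : Congruent₂ _+_
      *-cong        : Congruent₂ _*_
      -‿cong        : Congruent₁ -_
      +-assoc       : Associative _+_
      +-comm        : Commutative _+_
      +-identityˡ   : LeftIdentity 0# _+_
      -‿inverseˡ    : LeftInverse 0# -_ _+_
      *-assoc       : Associative _*_
      *-comm        : Commutative _*_
      *-identityˡ   : LeftIdentity 1# _*_
      distribʳ      : _*_ DistributesOverʳ _+_

    ≈-setoid : Setoid 0ℓ 0ℓ
    ≈-setoid = record { isEquivalence = isEquivalence }

    isCommutativeRing : IsCommutativeRing _+_ _*_ -_ 0# 1#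
    isCommutativeRing = record
      { isRing = record
        { +-isAbelianGroup = record
          { isGroup = record
            { isMonoid = record
              { isSemigroup = record
                { isMagma = record { isEquivalence = isEquivalence ; ∙-cong = +-cong }
                ; assoc = +-assoc }
              ; identity = comm∧idˡ⇒id +-comm +-identityˡ }
            ; inverse = comm∧invˡ⇒inv +-comm -‿inverseˡ
            ; ⁻¹-cong = -‿cong }
          ; comm = +-comm }
        ; *-cong = *-cong
        ; *-assoc = *-assoc
        ; *-identity = comm∧idˡ⇒id *-comm *-identityˡ
        ; distrib = comm∧distrʳ⇒distr +-cong *-comm distribʳ }
      ; *-comm = *-comm }
      where open import Algebra.Consequences.Setoid ≈-setoid

  open IsCommutativeRingˡ public using () renaming (isCommutativeRing to isCommutativeRingˡ)

module Polynomials (R : CommutativeRing 0ℓ 0ℓ) where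
  open CommutativeRing R
  open Poly R
  open import Algebra.Properties.Ring ring using (-0#≈0#)
  private module ≈-Reasoning = Relation.Binary.Reasoning.Setoid setoid

  -- A record rather than _≈ₚ_ itself, which unfolds to a Π-type from which
  -- Agda cannot recover the two polynomials.
  infix 4 _≋_
  record _≋_ (f g : Pol) : Set where
    constructor coeffwise
    field coeff-≈ : f ≈ₚ g
  open _≋_ public

  ≋-refl : ∀ {f} → f ≋ f
  ≋-refl = coeffwise λ _ → refl

  ≋-sym : ∀ {f g} → f ≋ g → g ≋ f
  ≋-sym (coeffwise f≈g) = coeffwise λ n → sym (f≈g n)

  ≋-trans : ∀ {f g k} → f ≋ g → g ≋ k → f ≋ k
  ≋-trans (coeffwise f≈g) (coeffwise g≈k) = coeffwise λ n → trans (f≈g n) (g≈k n)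

  ≋-isEquivalence : IsEquivalence _≋_
  ≋-isEquivalence = record { refl = ≋-refl ; sym = ≋-sym ; trans = ≋-trans }

  ≋-setoid : Setoid 0ℓ 0ℓ
  ≋-setoid = record { isEquivalence = ≋-isEquivalence }

  ∷-cong : ∀ {a b f g} → a ≈ b → f ≋ g → a ∷ f ≋ b ∷ g
  ∷-cong a≈b (coeffwise f≈g) = coeffwise λ { zero → a≈b ; (suc n) → f≈g n }

  tailₚ : Pol → Pol
  tailₚ []      = []
  tailₚ (a ∷ f) = f

  coeff₀-cong : ∀ {f g} → f ≋ g → coeff f 0 ≈ coeff g 0
  coeff₀-cong (coeffwise f≈g) = f≈g 0

  tailₚ-cong : ∀ {f g} → f ≋ g → tailₚ f ≋ tailₚ g
  tailₚ-cong {[]}    {[]}    _               = ≋-refl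
  tailₚ-cong {[]}    {b ∷ g} (coeffwise f≈g) = coeffwise λ n → f≈g (suc n)
  tailₚ-cong {a ∷ f} {[]}    (coeffwise f≈g) = coeffwise λ n → f≈g (suc n)
  tailₚ-cong {a ∷ f} {b ∷ g} (coeffwise f≈g) = coeffwise λ n → f≈g (suc n)

  0∷[]≋[] : 0# ∷ [] ≋ []
  0∷[]≋[] = coeffwise λ { zero → refl ; (suc n) → refl }

  coeff-+ₚ : ∀ f g n → coeff (f +ₚ g) n ≈ coeff f n + coeff g n
  coeff-+ₚ []      g       n       = sym (+-identityˡ _)
  coeff-+ₚ (a ∷ f) []      n       = sym (+-identityʳ _)
  coeff-+ₚ (a ∷ f) (b ∷ g) zero    = refl
  coeff-+ₚ (a ∷ f) (b ∷ g) (suc n) = coeff-+ₚ f g n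

  coeff-negate : ∀ f n → coeff (-ₚ f) n ≈ - coeff f n
  coeff-negate []      n       = sym -0#≈0#
  coeff-negate (a ∷ f) zero    = refl
  coeff-negate (a ∷ f) (suc n) = coeff-negate f n

  coeff-scale : ∀ a f n → coeff (scale a f) n ≈ a * coeff f n
  coeff-scale a []      n       = sym (zeroʳ a)
  coeff-scale a (b ∷ f) zero    = refl
  coeff-scale a (b ∷ f) (suc n) = coeff-scale a f n

  +ₚ-cong : ∀ {f g u v} → f ≋ g → u ≋ v → f +ₚ u ≋ g +ₚ v
  +ₚ-cong {f} {g} {u} {v} (coeffwise f≈g) (coeffwise u≈v) = coeffwise λ n → begin
    coeff (f +ₚ u) n      ≈⟨ coeff-+ₚ f u n ⟩
    coeff f n + coeff u n ≈⟨ +-cong (f≈g n) (u≈v n) ⟩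
    coeff g n + coeff v n ≈⟨ coeff-+ₚ g v n ⟨
    coeff (g +ₚ v) n      ∎
    where open ≈-Reasoning

  -ₚ-cong : ∀ {f g} → f ≋ g → -ₚ f ≋ -ₚ g
  -ₚ-cong {f} {g} (coeffwise f≈g) = coeffwise λ n →
    trans (coeff-negate f n) (trans (-‿cong (f≈g n)) (sym (coeff-negate g n)))

  +ₚ-assoc : ∀ f g k → (f +ₚ g) +ₚ k ≋ f +ₚ (g +ₚ k)
  +ₚ-assoc f g k = coeffwise λ n → begin
    coeff ((f +ₚ g) +ₚ k) n                  ≈⟨ trans (coeff-+ₚ (f +ₚ g) k n) (+-congʳ (coeff-+ₚ f g n)) ⟩
    (coeff f n + coeff g n) + coeff k n      ≈⟨ +-assoc _ _ _ ⟩
    coeff f n + (coeff g n + coeff k n)      ≈⟨ trans (coeff-+ₚ f (g +ₚ k) n) (+-congˡ (coeff-+ₚ g k n)) ⟨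
    coeff (f +ₚ (g +ₚ k)) n                  ∎
    where open ≈-Reasoning

  +ₚ-comm : ∀ f g → f +ₚ g ≋ g +ₚ f
  +ₚ-comm f g = coeffwise λ n → trans (coeff-+ₚ f g n) (trans (+-comm _ _) (sym (coeff-+ₚ g f n)))

  +ₚ-identityʳ : ∀ f → f +ₚ [] ≋ f
  +ₚ-identityʳ f = coeffwise λ n → trans (coeff-+ₚ f [] n) (+-identityʳ _)

  -ₚ‿inverseˡ : ∀ f → (-ₚ f) +ₚ f ≋ []
  -ₚ‿inverseˡ f = coeffwise λ n →
    trans (coeff-+ₚ (-ₚ f) f n) (trans (+-congʳ (coeff-negate f n)) (-‿inverseˡ _))

  module ≋-Reasoning = Relation.Binary.Reasoning.Setoid ≋-setoid
  open import Algebra.Consequences.Setoid ≋-setoid using (comm∧assoc⇒middleFour)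

  +ₚ-middleFour : ∀ f g u v → (f +ₚ g) +ₚ (u +ₚ v) ≋ (f +ₚ u) +ₚ (g +ₚ v)
  +ₚ-middleFour = comm∧assoc⇒middleFour +ₚ-cong +ₚ-comm +ₚ-assoc

  scale-cong : ∀ {a b f g} → a ≈ b → f ≋ g → scale a f ≋ scale b g
  scale-cong {a} {b} {f} {g} a≈b (coeffwise f≈g) = coeffwise λ n →
    trans (coeff-scale a f n) (trans (*-cong a≈b (f≈g n)) (sym (coeff-scale b g n)))

  scale-zero : ∀ {a} f → a ≈ 0# → scale a f ≋ []
  scale-zero {a} f a≈0 = coeffwise λ n → trans (coeff-scale a f n) (trans (*-congʳ a≈0) (zeroˡ _))

  scale-+ₚ : ∀ a f g → scale a (f +ₚ g) ≋ scale a f +ₚ scale a g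
  scale-+ₚ a f g = coeffwise λ n → begin
    coeff (scale a (f +ₚ g)) n                      ≈⟨ trans (coeff-scale a (f +ₚ g) n) (*-congˡ (coeff-+ₚ f g n)) ⟩
    a * (coeff f n + coeff g n)                     ≈⟨ distribˡ a _ _ ⟩
    a * coeff f n + a * coeff g n                   ≈⟨ trans (coeff-+ₚ (scale a f) (scale a g) n) (+-cong (coeff-scale a f n) (coeff-scale a g n)) ⟨
    coeff (scale a f +ₚ scale a g) n                ∎
    where open ≈-Reasoning

  scale-distrib : ∀ a b f → scale (a + b) f ≋ scale a f +ₚ scale b f
  scale-distrib a b f = coeffwise λ n → begin
    coeff (scale (a + b) f) n           ≈⟨ coeff-scale (a + b) f n ⟩
    (a + b) * coeff f n                 ≈⟨ distribʳ _ a b ⟩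
    a * coeff f n + b * coeff f n       ≈⟨ trans (coeff-+ₚ (scale a f) (scale b f) n) (+-cong (coeff-scale a f n) (coeff-scale b f n)) ⟨
    coeff (scale a f +ₚ scale b f) n    ∎
    where open ≈-Reasoning

  scale-scale : ∀ a b f → scale a (scale b f) ≋ scale (a * b) f
  scale-scale a b f = coeffwise λ n →
    trans (coeff-scale a (scale b f) n) (trans (*-congˡ (coeff-scale b f n))
      (trans (sym (*-assoc a b _)) (sym (coeff-scale (a * b) f n))))

  scale-1 : ∀ f → scale 1# f ≋ f
  scale-1 f = coeffwise λ n → trans (coeff-scale 1# f n) (*-identityˡ _)

  *ₚ-zeroʳ : ∀ f → f *ₚ [] ≋ []
  *ₚ-zeroʳ []      = ≋-refl
  *ₚ-zeroʳ (a ∷ f) = ≋-trans (∷-cong refl (*ₚ-zeroʳ f)) 0∷[]≋[]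

  *ₚ-annihilateˡ : ∀ {f} k → f ≋ [] → f *ₚ k ≋ []
  *ₚ-annihilateˡ {[]}    k _    = ≋-refl
  *ₚ-annihilateˡ {a ∷ f} k a∷f≋0 = ≋-trans
    (+ₚ-cong (scale-zero k (coeff₀-cong a∷f≋0)) (∷-cong refl (*ₚ-annihilateˡ {f} k (tailₚ-cong a∷f≋0)))) 0∷[]≋[]

  *ₚ-congˡ : ∀ k {f g} → f ≋ g → k *ₚ f ≋ k *ₚ g
  *ₚ-congˡ []      f≋g = ≋-refl
  *ₚ-congˡ (a ∷ k) f≋g = +ₚ-cong (scale-cong refl f≋g) (∷-cong refl (*ₚ-congˡ k f≋g))

  *ₚ-congʳ : ∀ k {f g} → f ≋ g → f *ₚ k ≋ g *ₚ k
  *ₚ-congʳ k {[]}    {g}     f≋g = ≋-sym (*ₚ-annihilateˡ k (≋-sym f≋g))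
  *ₚ-congʳ k {a ∷ f} {[]}    f≋g = *ₚ-annihilateˡ k f≋g
  *ₚ-congʳ k {a ∷ f} {b ∷ g} f≋g =
    +ₚ-cong (scale-cong (coeff₀-cong f≋g) ≋-refl) (∷-cong refl (*ₚ-congʳ k {f} {g} (tailₚ-cong f≋g)))

  *ₚ-cong : ∀ {f g u v} → f ≋ g → u ≋ v → f *ₚ u ≋ g *ₚ v
  *ₚ-cong {g = g} {u} f≋g u≋v = ≋-trans (*ₚ-congʳ u f≋g) (*ₚ-congˡ g u≋v)

  0∷-*ₚ : ∀ f k → (0# ∷ f) *ₚ k ≋ 0# ∷ (f *ₚ k)
  0∷-*ₚ f k = +ₚ-cong (scale-zero k refl) ≋-refl

  scale-*ₚ : ∀ a f g → (scale a f) *ₚ g ≋ scale a (f *ₚ g)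
  scale-*ₚ a []      g = ≋-refl
  scale-*ₚ a (b ∷ f) g = begin
    scale (a * b) g +ₚ (0# ∷ (scale a f *ₚ g))        ≈⟨ +ₚ-cong (≋-sym (scale-scale a b g)) (∷-cong (sym (zeroʳ a)) (scale-*ₚ a f g)) ⟩
    scale a (scale b g) +ₚ scale a (0# ∷ (f *ₚ g))    ≈⟨ scale-+ₚ a (scale b g) (0# ∷ (f *ₚ g)) ⟨
    scale a (scale b g +ₚ (0# ∷ (f *ₚ g)))            ∎
    where open ≋-Reasoning

  *ₚ-distribʳ : ∀ k f g → (f +ₚ g) *ₚ k ≋ (f *ₚ k) +ₚ (g *ₚ k)
  *ₚ-distribʳ k []      g       = ≋-refl
  *ₚ-distribʳ k (a ∷ f) []      = ≋-sym (+ₚ-identityʳ _)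
  *ₚ-distribʳ k (a ∷ f) (b ∷ g) = begin
    scale (a + b) k +ₚ (0# ∷ ((f +ₚ g) *ₚ k))
      ≈⟨ +ₚ-cong (scale-distrib a b k) (∷-cong (sym (+-identityˡ 0#)) (*ₚ-distribʳ k f g)) ⟩
    (scale a k +ₚ scale b k) +ₚ ((0# ∷ (f *ₚ k)) +ₚ (0# ∷ (g *ₚ k)))
      ≈⟨ +ₚ-middleFour (scale a k) (scale b k) (0# ∷ (f *ₚ k)) (0# ∷ (g *ₚ k)) ⟩
    ((a ∷ f) *ₚ k) +ₚ ((b ∷ g) *ₚ k)
      ∎
    where open ≋-Reasoning

  *ₚ-∷ʳ : ∀ f b g → f *ₚ (b ∷ g) ≋ scale b f +ₚ (0# ∷ (f *ₚ g))
  *ₚ-∷ʳ []      b g = ≋-sym 0∷[]≋[]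
  *ₚ-∷ʳ (a ∷ f) b g = ∷-cong (+-congʳ (*-comm a b)) (begin
    scale a g +ₚ (f *ₚ (b ∷ g))                        ≈⟨ +ₚ-cong ≋-refl (*ₚ-∷ʳ f b g) ⟩
    scale a g +ₚ (scale b f +ₚ (0# ∷ (f *ₚ g)))        ≈⟨ +ₚ-assoc (scale a g) (scale b f) (0# ∷ (f *ₚ g)) ⟨
    (scale a g +ₚ scale b f) +ₚ (0# ∷ (f *ₚ g))        ≈⟨ +ₚ-cong (+ₚ-comm (scale a g) (scale b f)) ≋-refl ⟩
    (scale b f +ₚ scale a g) +ₚ (0# ∷ (f *ₚ g))        ≈⟨ +ₚ-assoc (scale b f) (scale a g) (0# ∷ (f *ₚ g)) ⟩
    scale b f +ₚ (scale a g +ₚ (0# ∷ (f *ₚ g)))        ∎)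
    where open ≋-Reasoning

  *ₚ-comm : ∀ f g → f *ₚ g ≋ g *ₚ f
  *ₚ-comm []      g = ≋-sym (*ₚ-zeroʳ g)
  *ₚ-comm (a ∷ f) g = ≋-trans (+ₚ-cong ≋-refl (∷-cong refl (*ₚ-comm f g))) (≋-sym (*ₚ-∷ʳ g a f))

  *ₚ-assoc : ∀ f g k → (f *ₚ g) *ₚ k ≋ f *ₚ (g *ₚ k)
  *ₚ-assoc []      g k = ≋-refl
  *ₚ-assoc (a ∷ f) g k = ≋-trans (*ₚ-distribʳ k (scale a g) (0# ∷ (f *ₚ g)))
    (+ₚ-cong (scale-*ₚ a g k) (≋-trans (0∷-*ₚ (f *ₚ g) k) (∷-cong refl (*ₚ-assoc f g k))))

  *ₚ-identityˡ : ∀ f → oneₚ *ₚ f ≋ f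
  *ₚ-identityˡ f = ≋-trans (+ₚ-cong (scale-1 f) 0∷[]≋[]) (+ₚ-identityʳ f)

  polynomialRing : CommutativeRing 0ℓ 0ℓ
  polynomialRing = record
    { Carrier = Pol ; _≈_ = _≋_ ; _+_ = _+ₚ_ ; _*_ = _*ₚ_ ; -_ = -ₚ_ ; 0# = [] ; 1# = oneₚ
    ; isCommutativeRing = isCommutativeRingˡ record
      { isEquivalence = ≋-isEquivalence
      ; +-cong = +ₚ-cong ; *-cong = *ₚ-cong ; -‿cong = -ₚ-cong
      ; +-assoc = +ₚ-assoc ; +-comm = +ₚ-comm ; +-identityˡ = λ f → ≋-refl {f} ; -‿inverseˡ = -ₚ‿inverseˡ
      ; *-assoc = *ₚ-assoc ; *-comm = *ₚ-comm ; *-identityˡ = *ₚ-identityˡ ; distribʳ = *ₚ-distribʳ } }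

  const-cong : ∀ {a b} → a ≈ b → const a ≋ const b
  const-cong a≈b = ∷-cong a≈b ≋-refl

  const-* : ∀ a b → const a *ₚ const b ≋ const (a * b)
  const-* a b = ∷-cong (+-identityʳ _) ≋-refl

  module CarlitzProducts (q : ℕ) where

    L-without : ℕ → ℕ → Pol
    L-without k zero = oneₚ
    L-without k (suc n) with k ℕₚ.≟ suc n
    ... | yes _ = L q n
    ... | no  _ = bracket q (suc n) *ₚ L-without k n

    L≋bracket*L-without : ∀ {k} n → 1 ℕ.≤ k → k ℕ.≤ n → L q n ≋ bracket q k *ₚ L-without k n
    L≋bracket*L-without {suc _} zero    _   ()
    L≋bracket*L-without {k}     (suc n) 1≤k k≤1+n with k ℕₚ.≟ suc n
    ... | yes ≡.refl = ≋-refl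
    ... | no  k≢1+n  = begin
      bracket q (suc n) *ₚ L q n                            ≈⟨ *ₚ-congˡ (bracket q (suc n)) (L≋bracket*L-without n 1≤k k≤n) ⟩
      bracket q (suc n) *ₚ (bracket q k *ₚ L-without k n)   ≈⟨ *ₚ-assoc (bracket q (suc n)) (bracket q k) _ ⟨
      (bracket q (suc n) *ₚ bracket q k) *ₚ L-without k n   ≈⟨ *ₚ-congʳ (L-without k n) (*ₚ-comm (bracket q (suc n)) (bracket q k)) ⟩
      (bracket q k *ₚ bracket q (suc n)) *ₚ L-without k n   ≈⟨ *ₚ-assoc (bracket q k) (bracket q (suc n)) _ ⟩
      bracket q k *ₚ (bracket q (suc n) *ₚ L-without k n)   ∎
      where
      open ≋-Reasoning
      k≤n = ℕₚ.≤-pred (ℕₚ.≤∧≢⇒< k≤1+n k≢1+n)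

module PrincipalQuotient (S : CommutativeRing 0ℓ 0ℓ) (h : CommutativeRing.Carrier S) where
  open CommutativeRing S
  open import Algebra.Properties.Ring ring using (⁻¹-anti-homo‿-; -‿+-comm; -‿distribʳ-*)
  open RingLemmas S
  open import Relation.Binary.Reasoning.Setoid setoid

  infix 4 _≈ₕ_
  infix 1 _by_
  record _≈ₕ_ (x y : Carrier) : Set where
    constructor _by_
    field
      cofactor   : Carrier
      difference : x - y ≈ h * cofactor

  ≈⇒≈ₕ : ∀ {x y} → x ≈ y → x ≈ₕ y
  ≈⇒≈ₕ {x} {y} x≈y = 0# by trans (trans (+-congʳ x≈y) (-‿inverseʳ y)) (sym (zeroʳ h))

  ≈ₕ-sym : ∀ {x y} → x ≈ₕ y → y ≈ₕ x
  ≈ₕ-sym {x} {y} (k by x-y≈hk) = (- k) by (begin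
    y - x       ≈⟨ ⁻¹-anti-homo‿- x y ⟨
    - (x - y)   ≈⟨ -‿cong x-y≈hk ⟩
    - (h * k)   ≈⟨ -‿distribʳ-* h k ⟩
    h * - k     ∎)

  ≈ₕ-trans : ∀ {x y z} → x ≈ₕ y → y ≈ₕ z → x ≈ₕ z
  ≈ₕ-trans {x} {y} {z} (k by x-y≈hk) (l by y-z≈hl) = k + l by (begin
    x - z             ≈⟨ telescope x y z ⟨
    (x - y) + (y - z) ≈⟨ +-cong x-y≈hk y-z≈hl ⟩
    h * k + h * l     ≈⟨ distribˡ h k l ⟨
    h * (k + l)       ∎)

  +-congₕ : ∀ {x y u v} → x ≈ₕ y → u ≈ₕ v → x + u ≈ₕ y + v
  +-congₕ {x} {y} {u} {v} (k by x-y≈hk) (l by u-v≈hl) = k + l by (begin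
    (x + u) - (y + v) ≈⟨ +-minus-+ x y u v ⟩
    (x - y) + (u - v) ≈⟨ +-cong x-y≈hk u-v≈hl ⟩
    h * k + h * l     ≈⟨ distribˡ h k l ⟨
    h * (k + l)       ∎)

  -‿congₕ : ∀ {x y} → x ≈ₕ y → - x ≈ₕ - y
  -‿congₕ {x} {y} (k by x-y≈hk) = (- k) by (begin
    - x - - y   ≈⟨ -‿+-comm x (- y) ⟩
    - (x - y)   ≈⟨ -‿cong x-y≈hk ⟩
    - (h * k)   ≈⟨ -‿distribʳ-* h k ⟩
    h * - k     ∎)

  *-congₕ : ∀ {x y u v} → x ≈ₕ y → u ≈ₕ v → x * u ≈ₕ y * v
  *-congₕ {x} {y} {u} {v} (k by x-y≈hk) (l by u-v≈hl) = k * u + y * l by (begin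
    x * u - y * v               ≈⟨ *-minus-* x y u v ⟩
    (x - y) * u + y * (u - v)   ≈⟨ +-cong (*-congʳ x-y≈hk) (*-congˡ u-v≈hl) ⟩
    (h * k) * u + y * (h * l)   ≈⟨ +-cong (*-assoc h k u) (x∙yz≈y∙xz y h l) ⟩
    h * (k * u) + h * (y * l)   ≈⟨ distribˡ h (k * u) (y * l) ⟨
    h * (k * u + y * l)         ∎)
    where open import Algebra.Properties.CommutativeSemigroup *-commutativeSemigroup using (x∙yz≈y∙xz)

  quotientRing : CommutativeRing 0ℓ 0ℓ
  quotientRing = record
    { Carrier = Carrier ; _≈_ = _≈ₕ_ ; _+_ = _+_ ; _*_ = _*_ ; -_ = -_ ; 0# = 0# ; 1# = 1#
    ; isCommutativeRing = isCommutativeRingˡ record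
      { isEquivalence = record { refl = ≈⇒≈ₕ refl ; sym = ≈ₕ-sym ; trans = ≈ₕ-trans }
      ; +-cong = +-congₕ ; *-cong = *-congₕ ; -‿cong = -‿congₕ
      ; +-assoc = λ x y z → ≈⇒≈ₕ (+-assoc x y z) ; +-comm = λ x y → ≈⇒≈ₕ (+-comm x y)
      ; +-identityˡ = λ x → ≈⇒≈ₕ (+-identityˡ x) ; -‿inverseˡ = λ x → ≈⇒≈ₕ (-‿inverseˡ x)
      ; *-assoc = λ x y z → ≈⇒≈ₕ (*-assoc x y z) ; *-comm = λ x y → ≈⇒≈ₕ (*-comm x y)
      ; *-identityˡ = λ x → ≈⇒≈ₕ (*-identityˡ x) ; distribʳ = λ x y z → ≈⇒≈ₕ (distribʳ x y z) } }

[1+k]*[1+n]C[1+k]≡[1+n]*nCk : ∀ n k → suc k ℕ.* (suc n C suc k) ≡ suc n ℕ.* (n C k)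
[1+k]*[1+n]C[1+k]≡[1+n]*nCk zero    zero    = ≡.refl
[1+k]*[1+n]C[1+k]≡[1+n]*nCk zero    (suc k) = ℕₚ.*-zeroʳ (suc (suc k))
[1+k]*[1+n]C[1+k]≡[1+n]*nCk (suc n) zero    =
  ≡.trans (ℕₚ.*-identityˡ _) (≡.trans (nC1≡n (suc (suc n))) (≡.sym (ℕₚ.*-identityʳ _)))
[1+k]*[1+n]C[1+k]≡[1+n]*nCk (suc n) (suc k) = begin
  suc (suc k) ℕ.* c′           ≡⟨ ≡.cong (suc (suc k) ℕ.*_) (nCk+nC[k+1]≡[n+1]C[k+1] (suc n) (suc k)) ⟨
  suc (suc k) ℕ.* (c ℕ.+ d)    ≡⟨ solve 3 (λ K C D → (con 2 :+ K) :* (C :+ D) := ((con 1 :+ K) :* C :+ C) :+ (con 2 :+ K) :* D) ≡.refl k c d ⟩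
  (suc k ℕ.* c ℕ.+ c) ℕ.+ suc (suc k) ℕ.* d
    ≡⟨ ≡.cong₂ (λ u v → (u ℕ.+ c) ℕ.+ v) ([1+k]*[1+n]C[1+k]≡[1+n]*nCk n k) ([1+k]*[1+n]C[1+k]≡[1+n]*nCk n (suc k)) ⟩
  (suc n ℕ.* a ℕ.+ c) ℕ.+ suc n ℕ.* b
    ≡⟨ solve 4 (λ N A B C → ((con 1 :+ N) :* A :+ C) :+ (con 1 :+ N) :* B := (con 1 :+ N) :* (A :+ B) :+ C) ≡.refl n a b c ⟩
  suc n ℕ.* (a ℕ.+ b) ℕ.+ c    ≡⟨ ≡.cong (λ u → suc n ℕ.* u ℕ.+ c) (nCk+nC[k+1]≡[n+1]C[k+1] n k) ⟩
  suc n ℕ.* c ℕ.+ c            ≡⟨ solve 2 (λ N C → (con 1 :+ N) :* C :+ C := (con 2 :+ N) :* C) ≡.refl n c ⟩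
  suc (suc n) ℕ.* c            ∎
  where
  open ≡.≡-Reasoning
  open +-*-Solver
  a = n C k
  b = n C suc k
  c = suc n C suc k
  d = suc n C suc (suc k)
  c′ = suc (suc n) C suc (suc k)

prime∣pCk : ∀ {p k} → Prime p → 0 < k → k < p → p ∣ p C k
prime∣pCk {suc n} {suc k} p-prime _ k<p
  with euclidsLemma (suc k) (suc n C suc k) p-prime
         (≡.subst (suc n ∣_) (≡.sym ([1+k]*[1+n]C[1+k]≡[1+n]*nCk n k)) (m∣m*n (n C k)))
... | inj₁ p∣1+k = contradiction p∣1+k (>⇒∤ k<p)
... | inj₂ p∣pCk = p∣pCk

module BinomialPowers (S : CommutativeRing 0ℓ 0ℓ) where
  open CommutativeRing S hiding (zero)
  open import Algebra.Properties.Semiring.Mult semiring using (_×_; ×-assoc-*; ×-congʳ; ×-assocˡ; ×-homo-1)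
  open import Algebra.Properties.Semiring.Exp semiring using (^-assocʳ; ^-congˡ) renaming (_^_ to _^ᵣ_)
  open import Algebra.Properties.CommutativeSemiring.Binomial commutativeSemiring using (theorem; binomialTerm)
  open import Algebra.Properties.Monoid.Sum +-monoid using (sum; sum-init-last; sum-cong-≋; sum-replicate-zero)
  open import Relation.Binary.Reasoning.Setoid setoid

  inner-binomials-vanish⇒^-homo-+ : ∀ m → (∀ k w → 0 < k → k < suc m → (suc m C k) × w ≈ 0#) →
                                     ∀ x y → (x + y) ^ᵣ suc m ≈ x ^ᵣ suc m + y ^ᵣ suc m
  inner-binomials-vanish⇒^-homo-+ m inner≈0 x y = begin
    (x + y) ^ᵣ suc m                                         ≈⟨ theorem (suc m) x y ⟩
    term zero + sum (λ i → term (suc i))                     ≈⟨ +-cong first (sum-init-last (λ i → term (suc i))) ⟩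
    y ^ᵣ suc m + (sum (init (λ i → term (suc i))) + term (suc (fromℕ m)))
      ≈⟨ +-congˡ (+-cong (trans (sum-cong-≋ middle) (sum-replicate-zero m)) (last (fromℕ m) (toℕ-fromℕ m))) ⟩
    y ^ᵣ suc m + (0# + x ^ᵣ suc m)                           ≈⟨ +-congˡ (+-identityˡ _) ⟩
    y ^ᵣ suc m + x ^ᵣ suc m                                  ≈⟨ +-comm _ _ ⟩
    x ^ᵣ suc m + y ^ᵣ suc m                                  ∎
    where
    term = binomialTerm x y (suc m)
    first : term zero ≈ y ^ᵣ suc m
    first = trans (×-homo-1 _) (*-identityˡ _)
    middle : ∀ (i : Fin m) → term (suc (inject₁ i)) ≈ 0#
    middle i = inner≈0 (suc (toℕ (inject₁ i))) _ (ℕ.s≤s ℕ.z≤n)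
                 (ℕ.s≤s (≡.subst (ℕ._< m) (≡.sym (toℕ-inject₁ i)) (toℕ<n i)))
    last : ∀ (j : Fin (suc m)) → toℕ j ≡ m → term (suc j) ≈ x ^ᵣ suc m
    last j j≡m rewrite j≡m | nCn≡1 (suc m) | ℕₚ.n∸n≡0 m = trans (×-homo-1 _) (*-identityʳ _)

  module Frobenius {p} (p-prime : Prime p) (p×1≈0 : p × 1# ≈ 0#) where

    p×≈0 : ∀ x → p × x ≈ 0#
    p×≈0 x = begin
      p × x          ≈⟨ ×-congʳ p (*-identityˡ x) ⟨
      p × (1# * x)   ≈⟨ ×-assoc-* p 1# x ⟨
      (p × 1#) * x   ≈⟨ *-congʳ p×1≈0 ⟩
      0# * x         ≈⟨ zeroˡ x ⟩
      0#             ∎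

    inner-pCk×≈0 : ∀ k w → 0 < k → k < p → (p C k) × w ≈ 0#
    inner-pCk×≈0 k w 0<k k<p with prime∣pCk p-prime 0<k k<p
    ... | divides q pCk≡q*p rewrite pCk≡q*p =
      trans (sym (×-assocˡ w q p)) (trans (×-congʳ q (p×≈0 w)) (n×0≈0 q))
      where
      n×0≈0 : ∀ n → n × 0# ≈ 0#
      n×0≈0 zero    = refl
      n×0≈0 (suc n) = trans (+-identityˡ _) (n×0≈0 n)

    ^p-homo-+ : ∀ x y → (x + y) ^ᵣ p ≈ x ^ᵣ p + y ^ᵣ p
    ^p-homo-+ = homo p-prime inner-pCk×≈0
      where
      homo : ∀ {n} → Prime n → (∀ k w → 0 < k → k < n → (n C k) × w ≈ 0#) →
             ∀ x y → (x + y) ^ᵣ n ≈ x ^ᵣ n + y ^ᵣ n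
      homo {suc m} _ = inner-binomials-vanish⇒^-homo-+ m

    ^p^k-homo-+ : ∀ k x y → (x + y) ^ᵣ (p ^ k) ≈ x ^ᵣ (p ^ k) + y ^ᵣ (p ^ k)
    ^p^k-homo-+ zero    x y = trans (*-identityʳ _) (sym (+-cong (*-identityʳ x) (*-identityʳ y)))
    ^p^k-homo-+ (suc k) x y = begin
      (x + y) ^ᵣ (p ℕ.* p ^ k)                      ≈⟨ ^-assocʳ (x + y) p (p ^ k) ⟨
      ((x + y) ^ᵣ p) ^ᵣ (p ^ k)                     ≈⟨ ^-congˡ (p ^ k) (^p-homo-+ x y) ⟩
      (x ^ᵣ p + y ^ᵣ p) ^ᵣ (p ^ k)                  ≈⟨ ^p^k-homo-+ k (x ^ᵣ p) (y ^ᵣ p) ⟩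
      (x ^ᵣ p) ^ᵣ (p ^ k) + (y ^ᵣ p) ^ᵣ (p ^ k)     ≈⟨ +-cong (^-assocʳ x p (p ^ k)) (^-assocʳ y p (p ^ k)) ⟩
      x ^ᵣ (p ℕ.* p ^ k) + y ^ᵣ (p ℕ.* p ^ k)       ∎

module FiniteFieldUnits (F : CommutativeRing 0ℓ 0ℓ) (m : ℕ) (isFiniteField : IsFiniteField F (suc m)) where
  open CommutativeRing F hiding (zero)
  open IsFiniteField isFiniteField renaming (_≟_ to _≟F_)
  open import Algebra.Properties.Semiring.Exp semiring using () renaming (_^_ to _^ᵣ_)
  open import Algebra.Properties.CommutativeMonoid.Sum *-commutativeMonoid
    using (sum-remove; sum-permute; ∑-distrib-+; sum-cong-≋; sum-replicate) renaming (sum to ∏)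
  open import Relation.Binary.Reasoning.Setoid setoid

  *-nonzero : ∀ {a b} → ¬ a ≈ 0# → ¬ b ≈ 0# → ¬ a * b ≈ 0#
  *-nonzero {a} {b} a≉0 b≉0 ab≈0 with inverse a a≉0
  ... | a⁻¹ , aa⁻¹≈1 = b≉0 (begin
    b              ≈⟨ *-identityˡ b ⟨
    1# * b         ≈⟨ *-congʳ (trans (*-comm a⁻¹ a) aa⁻¹≈1) ⟨
    (a⁻¹ * a) * b  ≈⟨ *-assoc a⁻¹ a b ⟩
    a⁻¹ * (a * b)  ≈⟨ *-congˡ ab≈0 ⟩
    a⁻¹ * 0#       ≈⟨ zeroʳ a⁻¹ ⟩
    0#             ∎)

  ∏-nonzero : ∀ {n} (f : Fin n → Carrier) → (∀ i → ¬ f i ≈ 0#) → ¬ ∏ f ≈ 0#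
  ∏-nonzero {zero}  f f≉0 = 1≉0
  ∏-nonzero {suc n} f f≉0 = *-nonzero (f≉0 zero) (∏-nonzero (λ i → f (suc i)) (λ i → f≉0 (suc i)))

  -- ∏unitParts below is a unit, and multiplication by a ≠ 0 permutes F and
  -- rescales it by a^(q-1).
  unitPart : Carrier → Carrier
  unitPart x with x ≟F 0#
  ... | yes _ = 1#
  ... | no  _ = x

  unitPart-nonzero : ∀ x → ¬ unitPart x ≈ 0#
  unitPart-nonzero x with x ≟F 0#
  ... | yes _   = 1≉0
  ... | no  x≉0 = x≉0

  unitPart-cong : ∀ {x y} → x ≈ y → unitPart x ≈ unitPart y
  unitPart-cong {x} {y} x≈y with x ≟F 0# | y ≟F 0#
  ... | yes _   | yes _   = refl
  ... | yes x≈0 | no  y≉0 = contradiction (trans (sym x≈y) x≈0) y≉0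
  ... | no  x≉0 | yes y≈0 = contradiction (trans x≈y y≈0) x≉0
  ... | no  _   | no  _   = x≈y

  index : Carrier → Fin (suc m)
  index x = proj₁ (enum-surj x)

  enum-index : ∀ x → enum (index x) ≈ x
  enum-index x = proj₂ (enum-surj x)

  index-scale-cancel : ∀ b c x → b * c ≈ 1# → enum (index (b * enum (index (c * x)))) ≈ x
  index-scale-cancel b c x bc≈1 = begin
    enum (index (b * enum (index (c * x))))  ≈⟨ enum-index _ ⟩
    b * enum (index (c * x))                 ≈⟨ *-congˡ (enum-index (c * x)) ⟩
    b * (c * x)                              ≈⟨ *-assoc b c x ⟨
    (b * c) * x                              ≈⟨ *-congʳ bc≈1 ⟩
    1# * x                                   ≈⟨ *-identityˡ x ⟩
    x                                        ∎

  ∏unitParts : Carrier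
  ∏unitParts = ∏ (λ i → unitPart (enum i))

  ∏unitParts-nonzero : ¬ ∏unitParts ≈ 0#
  ∏unitParts-nonzero = ∏-nonzero _ (λ i → unitPart-nonzero (enum i))

  module _ (a : Carrier) (a≉0 : ¬ a ≈ 0#) where

    scaleFactor : Carrier → Carrier
    scaleFactor x with x ≟F 0#
    ... | yes _ = 1#
    ... | no  _ = a

    unitPart-* : ∀ x → unitPart (a * x) ≈ scaleFactor x * unitPart x
    unitPart-* x with x ≟F 0# | (a * x) ≟F 0#
    ... | yes _   | yes _    = sym (*-identityˡ 1#)
    ... | yes x≈0 | no  ax≉0 = contradiction (trans (*-congˡ x≈0) (zeroʳ a)) ax≉0
    ... | no  x≉0 | yes ax≈0 = contradiction ax≈0 (*-nonzero a≉0 x≉0)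
    ... | no  _   | no  _    = refl

    a⁻¹ : Carrier
    a⁻¹ = proj₁ (inverse a a≉0)

    aa⁻¹≈1 : a * a⁻¹ ≈ 1#
    aa⁻¹≈1 = proj₂ (inverse a a≉0)

    multiplication-by-a : Permutation′ (suc m)
    multiplication-by-a = permutation
      (λ i → index (a * enum i)) (λ j → index (a⁻¹ * enum j))
      (λ j → enum-inj _ _ (index-scale-cancel a a⁻¹ (enum j) aa⁻¹≈1))
      (λ i → enum-inj _ _ (index-scale-cancel a⁻¹ a (enum i) (trans (*-comm a⁻¹ a) aa⁻¹≈1)))

    ∏-scaleFactor : ∏ (λ i → scaleFactor (enum i)) ≈ a ^ᵣ m
    ∏-scaleFactor = begin
      ∏ (λ i → scaleFactor (enum i))                                ≈⟨ sum-remove {i = index 0#} (λ i → scaleFactor (enum i)) ⟩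
      scaleFactor (enum (index 0#)) * ∏ (removeAt (λ i → scaleFactor (enum i)) (index 0#))
        ≈⟨ *-cong (at-0 (enum (index 0#)) (enum-index 0#)) (sum-cong-≋ elsewhere) ⟩
      1# * ∏ (replicate m a)                                        ≈⟨ *-identityˡ _ ⟩
      ∏ (replicate m a)                                             ≈⟨ sum-replicate m ⟩
      a ^ᵣ m                                                        ∎
      where
      at-0 : ∀ x → x ≈ 0# → scaleFactor x ≈ 1#
      at-0 x x≈0 with x ≟F 0#
      ... | yes _   = refl
      ... | no  x≉0 = contradiction x≈0 x≉0
      at-nonzero : ∀ x → ¬ x ≈ 0# → scaleFactor x ≈ a
      at-nonzero x x≉0 with x ≟F 0#
      ... | yes x≈0 = contradiction x≈0 x≉0
      ... | no  _   = refl
      elsewhere : ∀ i → scaleFactor (enum (punchIn (index 0#) i)) ≈ a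
      elsewhere i = at-nonzero _ λ e≈0 →
        punchInᵢ≢i (index 0#) i (enum-inj _ _ (trans e≈0 (sym (enum-index 0#))))

    ∏unitParts≈a^m*∏unitParts : ∏unitParts ≈ a ^ᵣ m * ∏unitParts
    ∏unitParts≈a^m*∏unitParts = begin
      ∏unitParts                                      ≈⟨ sum-permute (λ i → unitPart (enum i)) multiplication-by-a ⟩
      ∏ (λ i → unitPart (enum (index (a * enum i))))  ≈⟨ sum-cong-≋ (λ i → unitPart-cong (enum-index (a * enum i))) ⟩
      ∏ (λ i → unitPart (a * enum i))                 ≈⟨ sum-cong-≋ (λ i → unitPart-* (enum i)) ⟩
      ∏ (λ i → scaleFactor (enum i) * unitPart (enum i))
        ≈⟨ ∑-distrib-+ (λ i → scaleFactor (enum i)) (λ i → unitPart (enum i)) ⟩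
      ∏ (λ i → scaleFactor (enum i)) * ∏unitParts     ≈⟨ *-congʳ ∏-scaleFactor ⟩
      a ^ᵣ m * ∏unitParts                             ∎

    a^m≈1 : a ^ᵣ m ≈ 1#
    a^m≈1 with inverse ∏unitParts ∏unitParts-nonzero
    ... | P⁻¹ , PP⁻¹≈1 = begin
      a ^ᵣ m                         ≈⟨ *-identityʳ _ ⟨
      a ^ᵣ m * 1#                    ≈⟨ *-congˡ PP⁻¹≈1 ⟨
      a ^ᵣ m * (∏unitParts * P⁻¹)    ≈⟨ *-assoc _ _ _ ⟨
      (a ^ᵣ m * ∏unitParts) * P⁻¹    ≈⟨ *-congʳ ∏unitParts≈a^m*∏unitParts ⟨
      ∏unitParts * P⁻¹               ≈⟨ PP⁻¹≈1 ⟩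
      1#                             ∎

  x^[1+m]≈x : ∀ x → x ^ᵣ suc m ≈ x
  x^[1+m]≈x x with x ≟F 0#
  ... | yes x≈0 = trans (*-congʳ x≈0) (trans (zeroˡ _) (sym x≈0))
  ... | no  x≉0 = trans (*-congˡ (a^m≈1 x x≉0)) (*-identityʳ x)

x^q≈x : ∀ (F : CommutativeRing 0ℓ 0ℓ) {q} → IsFiniteField F q → ∀ x →
        CommutativeRing._≈_ F (Exp._^_ (CommutativeRing.semiring F) x q) x
x^q≈x F {zero}  isFiniteField x with () ← proj₁ (IsFiniteField.enum-surj isFiniteField x)
x^q≈x F {suc m} isFiniteField   = FiniteFieldUnits.x^[1+m]≈x F m isFiniteField

n∸1≡[n∸suc-m]+m : ∀ {m n} → m < n → n ∸ 1 ≡ (n ∸ suc m) ℕ.+ m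
n∸1≡[n∸suc-m]+m {n = suc n} (ℕ.s≤s m≤n) = ≡.sym (ℕₚ.m∸n+n≡m m≤n)

m<n⇒m≤n∸1 : ∀ {m n} → m < n → m ℕ.≤ n ∸ 1
m<n⇒m≤n∸1 {n = suc _} (ℕ.s≤s m≤n) = m≤n

range : ℕ → ℕ → List ℕ
range s zero    = []
range s (suc n) = s ∷ range (suc s) n

range-∷ʳ : ∀ s n → range s (suc n) ≡ range s n ++ (s ℕ.+ n ∷ [])
range-∷ʳ s zero    = ≡.cong (λ t → t ∷ []) (≡.sym (ℕₚ.+-identityʳ s))
range-∷ʳ s (suc n) = ≡.cong (s ∷_) (≡.trans (range-∷ʳ (suc s) n) (≡.cong (λ t → range (suc s) n ++ (t ∷ [])) (≡.sym (ℕₚ.+-suc s n))))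

range-++ : ∀ s m n → range s (m ℕ.+ n) ≡ range s m ++ range (s ℕ.+ m) n
range-++ s zero    n = ≡.cong (λ t → range t n) (≡.sym (ℕₚ.+-identityʳ s))
range-++ s (suc m) n = ≡.cong (s ∷_) (≡.trans (range-++ (suc s) m n) (≡.cong (λ t → range (suc s) m ++ range t n) (≡.sym (ℕₚ.+-suc s m))))

range-shift : ∀ t s n → range (t ℕ.+ s) n ≡ map (t ℕ.+_) (range s n)
range-shift t s zero    = ≡.refl
range-shift t s (suc n) = ≡.cong (t ℕ.+ s ∷_) (≡.trans (≡.cong (λ u → range u n) (≡.sym (ℕₚ.+-suc t s))) (range-shift t (suc s) n))

All-range : ∀ {P : ℕ → Set} s n → (∀ j → s ℕ.≤ j → j < s ℕ.+ n → P j) → All P (range s n)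
All-range s zero    _ = []
All-range s (suc n) P-between = P-between s ℕₚ.≤-refl (ℕₚ.m<m+n s (ℕ.s≤s ℕ.z≤n))
  ∷ All-range (suc s) n λ j s<j j<s+1+n → P-between j (ℕₚ.<⇒≤ s<j) (≡.subst (j <_) (≡.sym (ℕₚ.+-suc s n)) j<s+1+n)

range-≥2 : ∀ s {n} → 1 < n → range s n ≡ s ∷ suc s ∷ range (suc (suc s)) (n ∸ 2)
range-≥2 s {suc (suc n)} _ = ≡.refl
range-≥2 s {suc zero} (ℕ.s≤s ())

AllPairs-range : ∀ {P : ℕ → ℕ → Set} n → (∀ i j → i < j → j < n → P i j) → AllPairs P (range 0 n)
AllPairs-range {P} n P-ordered = go 0 n ≡.refl
  where
  go : ∀ s m → s ℕ.+ m ≡ n → AllPairs P (range s m)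
  go s zero    _        = []
  go s (suc m) s+1+m≡n  =
    All-range (suc s) m (λ j s<j j<s+1+m → P-ordered s j s<j (≡.subst (j <_) (≡.trans (≡.sym (ℕₚ.+-suc s m)) s+1+m≡n) j<s+1+m))
    ∷ go (suc s) m (≡.trans (≡.sym (ℕₚ.+-suc s m)) s+1+m≡n)

module Products (S : CommutativeRing 0ℓ 0ℓ) where
  open CommutativeRing S
  open import Algebra.Properties.CommutativeSemigroup *-commutativeSemigroup using (interchange)

  ∏ : (ℕ → Carrier) → List ℕ → Carrier
  ∏ f []       = 1#
  ∏ f (i ∷ is) = f i * ∏ f is

  ∏-cong : ∀ {f g is} → All (λ j → f j ≈ g j) is → ∏ f is ≈ ∏ g is
  ∏-cong []               = refl
  ∏-cong (fi≈gi ∷ f≈g)    = *-cong fi≈gi (∏-cong f≈g)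

  ∏≈1 : ∀ {f is} → All (λ j → f j ≈ 1#) is → ∏ f is ≈ 1#
  ∏≈1 []            = refl
  ∏≈1 (fi≈1 ∷ f≈1)  = trans (*-cong fi≈1 (∏≈1 f≈1)) (*-identityˡ 1#)

  ∏-++ : ∀ f is js → ∏ f (is ++ js) ≈ ∏ f is * ∏ f js
  ∏-++ f []       js = sym (*-identityˡ _)
  ∏-++ f (i ∷ is) js = trans (*-congˡ (∏-++ f is js)) (sym (*-assoc _ _ _))

  ∏-map : ∀ f g is → ∏ f (map g is) ≡ ∏ (λ j → f (g j)) is
  ∏-map f g []       = ≡.refl
  ∏-map f g (i ∷ is) = ≡.cong (f (g i) *_) (∏-map f g is)

  ∏-distrib-* : ∀ f g is → ∏ f is * ∏ g is ≈ ∏ (λ j → f j * g j) is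
  ∏-distrib-* f g []       = *-identityˡ 1#
  ∏-distrib-* f g (i ∷ is) = trans (interchange _ _ _ _) (*-congˡ (∏-distrib-* f g is))

  ∏-homo : ∀ (φ : Carrier → Carrier) → φ 1# ≈ 1# → (∀ x y → φ (x * y) ≈ φ x * φ y) →
           ∀ f is → φ (∏ f is) ≈ ∏ (λ j → φ (f j)) is
  ∏-homo φ φ1≈1 φ-* f []       = φ1≈1
  ∏-homo φ φ1≈1 φ-* f (i ∷ is) = trans (φ-* (f i) (∏ f is)) (*-congˡ (∏-homo φ φ1≈1 φ-* f is))

  ∏-range-∷ʳ : ∀ f s n → ∏ f (range s (suc n)) ≈ ∏ f (range s n) * f (s ℕ.+ n)
  ∏-range-∷ʳ f s n = begin
    ∏ f (range s (suc n))                      ≡⟨ ≡.cong (∏ f) (range-∷ʳ s n) ⟩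
    ∏ f (range s n ++ (s ℕ.+ n ∷ []))          ≈⟨ ∏-++ f (range s n) (s ℕ.+ n ∷ []) ⟩
    ∏ f (range s n) * (f (s ℕ.+ n) * 1#)       ≈⟨ *-congˡ (*-identityʳ _) ⟩
    ∏ f (range s n) * f (s ℕ.+ n)              ∎
    where open import Relation.Binary.Reasoning.Setoid setoid

module PartialFractions (S : CommutativeRing 0ℓ 0ℓ) where
  open CommutativeRing S
  open Products S
  open RingLemmas S using (telescope; +-minus-+)
  open import Algebra.Properties.Ring ring using (⁻¹-anti-homo‿-; -‿distribʳ-*; -0#≈0#; [y-z]x≈yx-zx; x[y-z]≈xy-xz)
  open import Algebra.Properties.CommutativeSemigroup *-commutativeSemigroup using (xy∙z≈xz∙y)
  open import Algebra.Properties.Semiring.Mult semiring using (_×_)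
  open import Relation.Binary.Reasoning.Setoid setoid

  fractions-difference : ∀ {u v a b y} → (a - y) * u ≈ 1# → (b - y) * v ≈ 1# → (u * v) * (b - a) ≈ u - v
  fractions-difference {u} {v} {a} {b} {y} [a-y]u≈1 [b-y]v≈1 = begin
    (u * v) * (b - a)                          ≈⟨ *-congˡ (telescope b y a) ⟨
    (u * v) * ((b - y) + (y - a))              ≈⟨ distribˡ (u * v) (b - y) (y - a) ⟩
    (u * v) * (b - y) + (u * v) * (y - a)      ≈⟨ +-cong (trans (*-assoc u v _) (*-congˡ (trans (*-comm v _) [b-y]v≈1)))
                                                         (*-congˡ (sym (⁻¹-anti-homo‿- a y))) ⟩
    u * 1# + (u * v) * - (a - y)               ≈⟨ +-cong (*-identityʳ u) (sym (-‿distribʳ-* _ _)) ⟩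
    u - (u * v) * (a - y)                      ≈⟨ +-congˡ (-‿cong (trans (xy∙z≈xz∙y u v (a - y)) (*-congʳ (trans (*-comm u _) [a-y]u≈1)))) ⟩
    u - 1# * v                                 ≈⟨ +-congˡ (-‿cong (*-identityˡ v)) ⟩
    u - v                                      ∎

  module Lagrange (x : ℕ → Carrier) (e : ℕ → ℕ → Carrier) where

    Inverts : ℕ → ℕ → Set
    Inverts i j = (x j - x i) * e i j ≈ 1#

    ∏-Inverts : ∀ {i is} → All (Inverts i) is → ∏ (e i) is * ∏ (λ k → x k - x i) is ≈ 1#
    ∏-Inverts {i} {is} inverts = trans (∏-distrib-* (e i) (λ k → x k - x i) is)
      (∏≈1 (All.map (λ {k} ik → trans (*-comm (e i k) _) ik) inverts))

    -- lagrangeSum w l = Σ_{i ∈ l} w i · ∏_{j ∈ l, j ≠ i} e i j: the factors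
    -- e j i for the indices i preceding j are accumulated in the weight of j.
    lagrangeSum : (ℕ → Carrier) → List ℕ → Carrier
    lagrangeSum w []       = 0#
    lagrangeSum w (i ∷ is) = w i * ∏ (e i) is + lagrangeSum (λ j → w j * e j i) is

    lagrangeSum-cong : ∀ {v w : ℕ → Carrier} is → All (λ j → v j ≈ w j) is → lagrangeSum v is ≈ lagrangeSum w is
    lagrangeSum-cong []       _              = refl
    lagrangeSum-cong (i ∷ is) (vi≈wi ∷ v≈w) =
      +-cong (*-congʳ vi≈wi) (lagrangeSum-cong is (All.map (λ vj≈wj → *-congʳ vj≈wj) v≈w))

    lagrangeSum-* : ∀ (w : ℕ → Carrier) is c → lagrangeSum w is * c ≈ lagrangeSum (λ j → w j * c) is
    lagrangeSum-* w []       c = zeroˡ c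
    lagrangeSum-* w (i ∷ is) c = trans (distribʳ c _ _) (+-cong (xy∙z≈xz∙y (w i) _ c)
      (trans (lagrangeSum-* (λ j → w j * e j i) is c)
             (lagrangeSum-cong is (All.universal (λ j → xy∙z≈xz∙y (w j) (e j i) c) is))))

    lagrangeSum-minus : ∀ (v w : ℕ → Carrier) is → lagrangeSum v is - lagrangeSum w is ≈ lagrangeSum (λ j → v j - w j) is
    lagrangeSum-minus v w []       = -‿inverseʳ 0#
    lagrangeSum-minus v w (i ∷ is) = begin
      (v i * Pi + Sv) - (w i * Pi + Sw)                 ≈⟨ +-minus-+ (v i * Pi) (w i * Pi) Sv Sw ⟩
      (v i * Pi - w i * Pi) + (Sv - Sw)
        ≈⟨ +-cong ([y-z]x≈yx-zx Pi (v i) (w i)) (sym (lagrangeSum-minus (λ j → v j * e j i) (λ j → w j * e j i) is)) ⟨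
      (v i - w i) * Pi + lagrangeSum (λ j → v j * e j i - w j * e j i) is
        ≈⟨ +-congˡ (lagrangeSum-cong is (All.universal (λ j → sym ([y-z]x≈yx-zx (e j i) (v j) (w j))) is)) ⟩
      (v i - w i) * Pi + lagrangeSum (λ j → (v j - w j) * e j i) is ∎
      where
      Pi = ∏ (e i) is
      Sv = lagrangeSum (λ j → v j * e j i) is
      Sw = lagrangeSum (λ j → w j * e j i) is

    lagrangeSum-step : ∀ (w : ℕ → Carrier) a b is → All (λ j → Inverts j a) is → All (λ j → Inverts j b) is →
      lagrangeSum (λ j → w j * e j a * e j b) is * (x b - x a)
        ≈ lagrangeSum (λ j → w j * e j a) is - lagrangeSum (λ j → w j * e j b) is
    lagrangeSum-step w a b is inverts-a inverts-b = begin
      lagrangeSum (λ j → w j * e j a * e j b) is * (x b - x a)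
        ≈⟨ lagrangeSum-* (λ j → w j * e j a * e j b) is (x b - x a) ⟩
      lagrangeSum (λ j → w j * e j a * e j b * (x b - x a)) is
        ≈⟨ lagrangeSum-cong is (All.zipWith (λ (ja , jb) → term ja jb) (inverts-a , inverts-b)) ⟩
      lagrangeSum (λ j → w j * e j a - w j * e j b) is
        ≈⟨ lagrangeSum-minus (λ j → w j * e j a) (λ j → w j * e j b) is ⟨
      lagrangeSum (λ j → w j * e j a) is - lagrangeSum (λ j → w j * e j b) is ∎
      where
      term : ∀ {j} → Inverts j a → Inverts j b → w j * e j a * e j b * (x b - x a) ≈ w j * e j a - w j * e j b
      term {j} ja jb = begin
        w j * e j a * e j b * (x b - x a)        ≈⟨ *-congʳ (*-assoc (w j) (e j a) (e j b)) ⟩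
        w j * (e j a * e j b) * (x b - x a)      ≈⟨ *-assoc (w j) _ _ ⟩
        w j * (e j a * e j b * (x b - x a))      ≈⟨ *-congˡ (fractions-difference ja jb) ⟩
        w j * (e j a - e j b)                    ≈⟨ x[y-z]≈xy-xz (w j) (e j a) (e j b) ⟩
        w j * e j a - w j * e j b                ∎

    lagrangeSum-pair : ∀ a b is → Inverts a b → Inverts b a →
      All (λ j → Inverts j a) is → All (λ j → Inverts j b) is →
      lagrangeSum (λ _ → 1#) (a ∷ b ∷ is) * (x b - x a)
        ≈ lagrangeSum (λ _ → 1#) (a ∷ is) - lagrangeSum (λ _ → 1#) (b ∷ is)
    lagrangeSum-pair a b is ab ba inverts-a inverts-b = begin
      (Ta + (Tb + Tab)) * c                 ≈⟨ trans (distribʳ c _ _) (+-congˡ (distribʳ c _ _)) ⟩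
      Ta * c + (Tb * c + Tab * c)           ≈⟨ +-cong first (+-cong second (lagrangeSum-step (λ _ → 1#) a b is inverts-a inverts-b)) ⟩
      Pa + (- Pb + (Sa - Sb))               ≈⟨ +-assoc Pa (- Pb) (Sa - Sb) ⟨
      (Pa - Pb) + (Sa - Sb)                 ≈⟨ +-minus-+ Pa Pb Sa Sb ⟨
      (Pa + Sa) - (Pb + Sb)                 ∎
      where
      c   = x b - x a
      Pa  = 1# * ∏ (e a) is
      Pb  = 1# * ∏ (e b) is
      Ta  = 1# * (e a b * ∏ (e a) is)
      Tb  = (1# * e b a) * ∏ (e b) is
      Tab = lagrangeSum (λ j → 1# * e j a * e j b) is
      Sa  = lagrangeSum (λ j → 1# * e j a) is
      Sb  = lagrangeSum (λ j → 1# * e j b) is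
      first : Ta * c ≈ Pa
      first = begin
        (1# * (e a b * ∏ (e a) is)) * c   ≈⟨ *-congʳ (*-congˡ (*-comm (e a b) _)) ⟩
        (1# * (∏ (e a) is * e a b)) * c   ≈⟨ trans (*-congʳ (sym (*-assoc _ _ _))) (*-assoc _ _ _) ⟩
        Pa * (e a b * c)                  ≈⟨ *-congˡ (trans (*-comm _ _) ab) ⟩
        Pa * 1#                           ≈⟨ *-identityʳ Pa ⟩
        Pa                                ∎
      second : Tb * c ≈ - Pb
      second = begin
        Tb * c                            ≈⟨ *-congˡ (⁻¹-anti-homo‿- (x a) (x b)) ⟨
        Tb * - (x a - x b)                ≈⟨ -‿distribʳ-* Tb _ ⟨
        - (Tb * (x a - x b))              ≈⟨ -‿cong (trans (*-congʳ (xy∙z≈xz∙y 1# (e b a) _)) (trans (*-assoc _ _ _)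
                                               (trans (*-congˡ (trans (*-comm _ _) ba)) (*-identityʳ Pb)))) ⟩
        - Pb                              ∎

    -- Times x b - x a, the sum over a ∷ b ∷ is becomes the difference of the sums
    -- over a ∷ is and b ∷ is (lagrangeSum-pair), which vanish by induction or
    -- coincide when is = [].
    lagrangeSum≈0 : ∀ a b is → AllPairs Inverts (a ∷ b ∷ is) → AllPairs (flip Inverts) (a ∷ b ∷ is) →
                    lagrangeSum (λ _ → 1#) (a ∷ b ∷ is) ≈ 0#
    lagrangeSum≈0 a b is ((ab ∷ a-is) ∷ b-is ∷ is-is) ((ba ∷ is-a) ∷ is-b ∷ is-is′) = begin
      T                                       ≈⟨ *-identityʳ T ⟨
      T * 1#                                  ≈⟨ *-congˡ ab ⟨
      T * ((x b - x a) * e a b)               ≈⟨ *-assoc T _ _ ⟨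
      (T * (x b - x a)) * e a b               ≈⟨ *-congʳ (lagrangeSum-pair a b is ab ba is-a is-b) ⟩
      (Sa - Sb) * e a b                       ≈⟨ *-congʳ (Sa≈Sb is a-is b-is is-a is-b is-is is-is′) ⟩
      0# * e a b                              ≈⟨ zeroˡ _ ⟩
      0#                                      ∎
      where
      T  = lagrangeSum (λ _ → 1#) (a ∷ b ∷ is)
      Sa = lagrangeSum (λ _ → 1#) (a ∷ is)
      Sb = lagrangeSum (λ _ → 1#) (b ∷ is)
      Sa≈Sb : ∀ is → All (Inverts a) is → All (Inverts b) is → All (flip Inverts a) is → All (flip Inverts b) is →
              AllPairs Inverts is → AllPairs (flip Inverts) is →
              lagrangeSum (λ _ → 1#) (a ∷ is) - lagrangeSum (λ _ → 1#) (b ∷ is) ≈ 0#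
      Sa≈Sb []       _ _ _ _ _ _ = -‿inverseʳ _
      Sa≈Sb (c ∷ js) a-cjs b-cjs cjs-a cjs-b cjs-cjs cjs-cjs′ = trans
        (+-cong (lagrangeSum≈0 a c js (a-cjs ∷ cjs-cjs) (cjs-a ∷ cjs-cjs′))
                (-‿cong (lagrangeSum≈0 b c js (b-cjs ∷ cjs-cjs) (cjs-b ∷ cjs-cjs′))))
        (trans (+-congˡ -0#≈0#) (+-identityˡ 0#))

    lagrangeSum-range : ∀ w N n s → s ℕ.+ n ≡ N →
      (∀ j → s ℕ.≤ j → j < N → ∏ (e j) (range 0 j) * ∏ (e j) (range (suc j) (N ∸ suc j)) ≈ w) →
      lagrangeSum (λ i → ∏ (e i) (range 0 s)) (range s n) ≈ n × w
    lagrangeSum-range w N zero    s _        _     = refl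
    lagrangeSum-range w N (suc n) s s+1+n≡N terms = +-cong first (trans
      (lagrangeSum-cong (range (suc s) n) (All.universal (λ i → sym (∏-range-∷ʳ (e i) 0 s)) _))
      (lagrangeSum-range w N n (suc s) (≡.trans (≡.sym (ℕₚ.+-suc s n)) s+1+n≡N)
        (λ j s<j j<N → terms j (ℕₚ.<⇒≤ s<j) j<N)))
      where
      first : ∏ (e s) (range 0 s) * ∏ (e s) (range (suc s) n) ≈ w
      first = ≡.subst (λ m → ∏ (e s) (range 0 s) * ∏ (e s) (range (suc s) m) ≈ w)
                (≡.trans (≡.cong (_∸ suc s) (≡.trans (≡.sym s+1+n≡N) (ℕₚ.+-suc s n))) (ℕₚ.m+n∸m≡n s n))
                (terms s ℕₚ.≤-refl (≡.subst (s <_) s+1+n≡N (ℕₚ.m<m+n s (ℕ.s≤s ℕ.z≤n))))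

module Modulo (R : CommutativeRing 0ℓ 0ℓ) {q p : ℕ} (isFiniteField : IsFiniteField R q) (p-prime : Prime p)
            {k : ℕ} (q≡p^k : q ≡ p ^ k) (p×1≈0 : CommutativeRing._≈_ R (Poly.ntimes R p (CommutativeRing.1# R)) (CommutativeRing.0# R))
            (h : Poly.Pol R) (h-nonunit : ¬ Poly.IsUnitₚ R h) where
  open CommutativeRing R
  open Poly R
  open Polynomials R
  open CarlitzProducts q
  open IsFiniteField isFiniteField using (inverse) renaming (_≟_ to _≟R_)
  open PrincipalQuotient polynomialRing h using (_≈ₕ_; _by_; ≈⇒≈ₕ; quotientRing)

  private module Rₚ = Algebra.Properties.Ring ring

  module B = CommutativeRing quotientRing
  open import Algebra.Properties.Ring B.ring
    using (-‿distribʳ-*; -‿distribˡ-*; ⁻¹-anti-homo‿-; -1*x≈-x; x∙y⁻¹≈ε⇒x≈y; +-inverseˡ-unique)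
  open import Algebra.Properties.Semiring.Exp B.semiring using (^-assocʳ; ^-congˡ; ^-congʳ) renaming (_^_ to _^ₕ_)
  open import Algebra.Properties.CommutativeSemiring.Exp B.commutativeSemiring using (^-distrib-*)
  open import Algebra.Properties.Semiring.Mult B.semiring using (×-congʳ; ×-comm-*) renaming (_×_ to _×ₕ_)
  open import Algebra.Properties.Semiring.Exp semiring using () renaming (_^_ to _^ᵣ_)
  open import Relation.Binary.Reasoning.Setoid B.setoid

  ×ₕ-oneₚ : ∀ n → n ×ₕ oneₚ ≈ₕ const (ntimes n 1#)
  ×ₕ-oneₚ zero    = ≈⇒≈ₕ (≋-sym 0∷[]≋[])
  ×ₕ-oneₚ (suc n) = B.+-congˡ {oneₚ} (×ₕ-oneₚ n)

  const-^ : ∀ a n → const a ^ₕ n ≈ₕ const (a ^ᵣ n)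
  const-^ a zero    = B.refl
  const-^ a (suc n) = B.trans (B.*-congˡ {const a} (const-^ a n)) (≈⇒≈ₕ (const-* a (a ^ᵣ n)))

  ^ₚ≡^ₕ : ∀ f n → f ^ₚ n ≡ f ^ₕ n
  ^ₚ≡^ₕ f zero    = ≡.refl
  ^ₚ≡^ₕ f (suc n) = ≡.cong (f *ₚ_) (^ₚ≡^ₕ f n)

  oneₚ≉ₕ0 : ¬ oneₚ ≈ₕ []
  oneₚ≉ₕ0 (k by 1-0≈hk) = h-nonunit (k , coeff-≈ (≋-sym 1-0≈hk))

  const≈ₕ0⇒≈0 : ∀ {a} → const a ≈ₕ [] → a ≈ 0#
  const≈ₕ0⇒≈0 {a} a≈ₕ0 with a ≟R 0#
  ... | yes a≈0 = a≈0
  ... | no  a≉0 with inverse a a≉0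
  ... | a⁻¹ , aa⁻¹≈1 = contradiction (begin
    oneₚ                  ≈⟨ ≈⇒≈ₕ (const-cong aa⁻¹≈1) ⟨
    const (a * a⁻¹)       ≈⟨ ≈⇒≈ₕ (const-* a a⁻¹) ⟨
    const a *ₚ const a⁻¹  ≈⟨ B.*-congʳ {const a⁻¹} a≈ₕ0 ⟩
    [] *ₚ const a⁻¹       ≈⟨ B.refl ⟩
    []                    ∎) oneₚ≉ₕ0

  open BinomialPowers quotientRing using (module Frobenius)
  open Frobenius p-prime (B.trans (×ₕ-oneₚ p) (≈⇒≈ₕ (≋-trans (const-cong p×1≈0) 0∷[]≋[]))) using (^p^k-homo-+)

  Fr : Pol → Pol
  Fr f = f ^ₕ q

  Fr-+ : ∀ f g → Fr (f +ₚ g) ≈ₕ Fr f +ₚ Fr g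
  Fr-+ f g rewrite q≡p^k = ^p^k-homo-+ k f g

  Fr-* : ∀ f g → Fr (f *ₚ g) ≈ₕ Fr f *ₚ Fr g
  Fr-* f g = ^-distrib-* f g q

  Fr-cong : ∀ {f g} → f ≈ₕ g → Fr f ≈ₕ Fr g
  Fr-cong = ^-congˡ q

  Fr-const : ∀ a → Fr (const a) ≈ₕ const a
  Fr-const a = B.trans (const-^ a q) (≈⇒≈ₕ (const-cong (x^q≈x R isFiniteField a)))

  Fr-negate : ∀ f → Fr (-ₚ f) ≈ₕ -ₚ Fr f
  Fr-negate f = begin
    Fr (-ₚ f)                   ≈⟨ Fr-cong (-1*x≈-x f) ⟨
    Fr (const (- 1#) *ₚ f)      ≈⟨ Fr-* (const (- 1#)) f ⟩
    Fr (const (- 1#)) *ₚ Fr f   ≈⟨ B.*-congʳ {Fr f} (Fr-const (- 1#)) ⟩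
    const (- 1#) *ₚ Fr f        ≈⟨ -1*x≈-x (Fr f) ⟩
    -ₚ Fr f                     ∎

  Fr-minus : ∀ f g → Fr (f -ₚ g) ≈ₕ Fr f -ₚ Fr g
  Fr-minus f g = B.trans (Fr-+ f (-ₚ g)) (B.+-congˡ {Fr f} (Fr-negate g))

  Fr^ : ℕ → Pol → Pol
  Fr^ zero    f = f
  Fr^ (suc i) f = Fr (Fr^ i f)

  Fr^-cong : ∀ i {f g} → f ≈ₕ g → Fr^ i f ≈ₕ Fr^ i g
  Fr^-cong zero    f≈g = f≈g
  Fr^-cong (suc i) f≈g = Fr-cong (Fr^-cong i f≈g)

  Fr^-* : ∀ i f g → Fr^ i (f *ₚ g) ≈ₕ Fr^ i f *ₚ Fr^ i g
  Fr^-* zero    f g = B.refl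
  Fr^-* (suc i) f g = B.trans (Fr-cong (Fr^-* i f g)) (Fr-* (Fr^ i f) (Fr^ i g))

  Fr^-minus : ∀ i f g → Fr^ i (f -ₚ g) ≈ₕ Fr^ i f -ₚ Fr^ i g
  Fr^-minus zero    f g = B.refl
  Fr^-minus (suc i) f g = B.trans (Fr-cong (Fr^-minus i f g)) (Fr-minus (Fr^ i f) (Fr^ i g))

  Fr^-oneₚ : ∀ i → Fr^ i oneₚ ≈ₕ oneₚ
  Fr^-oneₚ zero    = B.refl
  Fr^-oneₚ (suc i) = B.trans (Fr-cong (Fr^-oneₚ i)) (Fr-const 1#)

  θ : ℕ → Pol
  θ i = T ^ₕ (q ^ i)

  Fr-θ : ∀ i → Fr (θ i) ≈ₕ θ (suc i)
  Fr-θ i = B.trans (^-assocʳ T (q ^ i) q) (^-congʳ T (ℕₚ.*-comm (q ^ i) q))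

  Fr^-θ : ∀ i j → Fr^ i (θ j) ≈ₕ θ (i ℕ.+ j)
  Fr^-θ zero    j = B.refl
  Fr^-θ (suc i) j = B.trans (Fr-cong (Fr^-θ i j)) (Fr-θ (i ℕ.+ j))

  θ0≈T : θ 0 ≈ₕ T
  θ0≈T = B.*-identityʳ T

  bracket≈θ-θ0 : ∀ n → bracket q n ≈ₕ θ n -ₚ θ 0
  bracket≈θ-θ0 n rewrite ^ₚ≡^ₕ T (q ^ n) = B.+-congˡ {θ n} (B.-‿cong (B.sym θ0≈T))

  h∣⇒≈ₕ0 : ∀ {f} → h ∣ₚ f → f ≈ₕ []
  h∣⇒≈ₕ0 {f} (k , f≈hk) = k by ≋-trans (+ₚ-identityʳ f) (coeffwise f≈hk)

  h∣[n]⇒θn≈θ0 : ∀ {n} → h ∣ₚ bracket q n → θ n ≈ₕ θ 0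
  h∣[n]⇒θn≈θ0 {n} h∣[n] = x∙y⁻¹≈ε⇒x≈y (θ n) (θ 0) (B.trans (B.sym (bracket≈θ-θ0 n)) (h∣⇒≈ₕ0 h∣[n]))

  h∣L+c⇒L≈-c : ∀ {n c} → h ∣ₚ (L q n +ₚ const c) → L q n ≈ₕ const (- c)
  h∣L+c⇒L≈-c {n} {c} h∣L+c = +-inverseˡ-unique (L q n) (const c) (h∣⇒≈ₕ0 h∣L+c)

  module Periodic {d} (1<d : 1 < d) (θd≈θ0 : θ d ≈ₕ θ 0)
                  {c} (c≉0 : ¬ c ≈ 0#) (L≈-c : L q (d ∸ 1) ≈ₕ const (- c)) where
    open Products quotientRing
    open PartialFractions quotientRing using (module Lagrange)

    θ-periodic : ∀ j → θ (d ℕ.+ j) ≈ₕ θ j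
    θ-periodic j = ≡.subst₂ (λ m n → θ m ≈ₕ θ n) (ℕₚ.+-comm j d) (ℕₚ.+-identityʳ j) (begin
      θ (j ℕ.+ d)      ≈⟨ Fr^-θ j d ⟨
      Fr^ j (θ d)      ≈⟨ Fr^-cong j θd≈θ0 ⟩
      Fr^ j (θ 0)      ≈⟨ Fr^-θ j 0 ⟩
      θ (j ℕ.+ 0)      ∎)

    -c≉0 : ¬ - c ≈ 0#
    -c≉0 -c≈0 = c≉0 (trans (sym (Rₚ.-‿involutive c)) (trans (-‿cong -c≈0) Rₚ.-0#≈0#))

    [-c]⁻¹ : Pol
    [-c]⁻¹ = const (proj₁ (inverse (- c) -c≉0))

    -c*[-c]⁻¹≈1 : const (- c) *ₚ [-c]⁻¹ ≈ₕ oneₚ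
    -c*[-c]⁻¹≈1 = ≈⇒≈ₕ (≋-trans (const-* (- c) _) (const-cong (proj₂ (inverse (- c) -c≉0))))

    x*-c≈1⇒x≈[-c]⁻¹ : ∀ {x} → x *ₚ const (- c) ≈ₕ oneₚ → x ≈ₕ [-c]⁻¹
    x*-c≈1⇒x≈[-c]⁻¹ {x} x*-c≈1 = begin
      x                                ≈⟨ B.*-identityʳ x ⟨
      x *ₚ oneₚ                        ≈⟨ B.*-congˡ {x} -c*[-c]⁻¹≈1 ⟨
      x *ₚ (const (- c) *ₚ [-c]⁻¹)     ≈⟨ B.*-assoc x (const (- c)) [-c]⁻¹ ⟨
      (x *ₚ const (- c)) *ₚ [-c]⁻¹     ≈⟨ B.*-congʳ {[-c]⁻¹} x*-c≈1 ⟩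
      oneₚ *ₚ [-c]⁻¹                   ≈⟨ B.*-identityˡ [-c]⁻¹ ⟩
      [-c]⁻¹                           ∎

    δ : ℕ → ℕ → Pol
    δ i j = θ j -ₚ θ i

    L≈∏ : ∀ n → L q n ≈ₕ ∏ (δ 0) (range 1 n)
    L≈∏ zero    = B.refl
    L≈∏ (suc n) = begin
      bracket q (suc n) *ₚ L q n                    ≈⟨ B.*-cong (bracket≈θ-θ0 (suc n)) (L≈∏ n) ⟩
      δ 0 (suc n) *ₚ ∏ (δ 0) (range 1 n)            ≈⟨ B.*-comm (δ 0 (suc n)) _ ⟩
      ∏ (δ 0) (range 1 n) *ₚ δ 0 (suc n)            ≈⟨ ∏-range-∷ʳ (δ 0) 1 n ⟨
      ∏ (δ 0) (range 1 (suc n))                     ∎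

    D : ℕ → Pol
    D i = ∏ (δ i) (range (suc i) (d ∸ 1))

    Fr-D : ∀ i → Fr (D i) ≈ₕ D (suc i)
    Fr-D i = begin
      Fr (D i)                                             ≈⟨ ∏-homo Fr (Fr-const 1#) Fr-* (δ i) window ⟩
      ∏ (λ j → Fr (δ i j)) window                          ≈⟨ ∏-cong {is = window} (All.universal Fr-δ window) ⟩
      ∏ (λ j → δ (suc i) (suc j)) window                   ≡⟨ ∏-map (δ (suc i)) suc window ⟨
      ∏ (δ (suc i)) (map suc window)                       ≡⟨ ≡.cong (∏ (δ (suc i))) (range-shift 1 (suc i) (d ∸ 1)) ⟨
      D (suc i)                                            ∎
      where
      window = range (suc i) (d ∸ 1)
      Fr-δ : ∀ j → Fr (δ i j) ≈ₕ δ (suc i) (suc j)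
      Fr-δ j = B.trans (Fr-minus (θ j) (θ i)) (B.+-cong (Fr-θ j) (B.-‿cong (Fr-θ i)))

    D≈-c : ∀ i → D i ≈ₕ const (- c)
    D≈-c zero    = B.trans (B.sym (L≈∏ (d ∸ 1))) L≈-c
    D≈-c (suc i) = B.trans (B.sym (Fr-D i)) (B.trans (Fr-cong (D≈-c i)) (Fr-const (- c)))

    D-split : ∀ {j} → j < d → D j ≈ₕ ∏ (δ j) (range 0 j) *ₚ ∏ (δ j) (range (suc j) (d ∸ suc j))
    D-split {j} j<d = begin
      ∏ (δ j) (range (suc j) (d ∸ 1))                                  ≡⟨ ≡.cong (λ n → ∏ (δ j) (range (suc j) n)) (n∸1≡[n∸suc-m]+m j<d) ⟩
      ∏ (δ j) (range (suc j) (above ℕ.+ j))                            ≡⟨ ≡.cong (∏ (δ j)) (range-++ (suc j) above j) ⟩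
      ∏ (δ j) (range (suc j) above ++ range (suc j ℕ.+ above) j)       ≈⟨ ∏-++ (δ j) (range (suc j) above) _ ⟩
      Dabove *ₚ ∏ (δ j) (range (suc j ℕ.+ above) j)                    ≡⟨ ≡.cong (λ s → Dabove *ₚ ∏ (δ j) (range s j)) 1+j+above≡d+0 ⟩
      Dabove *ₚ ∏ (δ j) (range (d ℕ.+ 0) j)                            ≡⟨ ≡.cong (λ l → Dabove *ₚ ∏ (δ j) l) (range-shift d 0 j) ⟩
      Dabove *ₚ ∏ (δ j) (map (d ℕ.+_) (range 0 j))                     ≡⟨ ≡.cong (Dabove *ₚ_) (∏-map (δ j) (d ℕ.+_) (range 0 j)) ⟩
      Dabove *ₚ ∏ (λ k → δ j (d ℕ.+ k)) (range 0 j)                    ≈⟨ B.*-congˡ {Dabove} (∏-cong {is = range 0 j}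
                                                                            (All.universal (λ k → B.+-congʳ { -ₚ θ j} (θ-periodic k)) (range 0 j))) ⟩
      Dabove *ₚ ∏ (δ j) (range 0 j)                                    ≈⟨ B.*-comm Dabove _ ⟩
      ∏ (δ j) (range 0 j) *ₚ Dabove                                    ∎
      where
      above = d ∸ suc j
      Dabove = ∏ (δ j) (range (suc j) above)
      1+j+above≡d+0 : suc j ℕ.+ above ≡ d ℕ.+ 0
      1+j+above≡d+0 = ≡.trans (ℕₚ.m+[n∸m]≡n j<d) (≡.sym (ℕₚ.+-identityʳ d))

    E : ℕ → Pol
    E k = L-without k (d ∸ 1) *ₚ [-c]⁻¹

    [θk-θ0]*Ek≈1 : ∀ {k} → 1 ℕ.≤ k → k ℕ.≤ d ∸ 1 → δ 0 k *ₚ E k ≈ₕ oneₚ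
    [θk-θ0]*Ek≈1 {k} 1≤k k≤d-1 = begin
      δ 0 k *ₚ (L-without k (d ∸ 1) *ₚ [-c]⁻¹)          ≈⟨ B.*-assoc (δ 0 k) (L-without k (d ∸ 1)) [-c]⁻¹ ⟨
      (δ 0 k *ₚ L-without k (d ∸ 1)) *ₚ [-c]⁻¹          ≈⟨ B.*-congʳ {[-c]⁻¹} (B.*-congʳ {L-without k (d ∸ 1)} (bracket≈θ-θ0 k)) ⟨
      (bracket q k *ₚ L-without k (d ∸ 1)) *ₚ [-c]⁻¹    ≈⟨ B.*-congʳ {[-c]⁻¹} (≈⇒≈ₕ (L≋bracket*L-without (d ∸ 1) 1≤k k≤d-1)) ⟨
      L q (d ∸ 1) *ₚ [-c]⁻¹                             ≈⟨ B.*-congʳ {[-c]⁻¹} L≈-c ⟩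
      const (- c) *ₚ [-c]⁻¹                             ≈⟨ -c*[-c]⁻¹≈1 ⟩
      oneₚ                                              ∎

    [θ[i+k]-θi]*Fr^iEk≈1 : ∀ i {k} → 1 ℕ.≤ k → k ℕ.≤ d ∸ 1 → (θ (i ℕ.+ k) -ₚ θ i) *ₚ Fr^ i (E k) ≈ₕ oneₚ
    [θ[i+k]-θi]*Fr^iEk≈1 i {k} 1≤k k≤d-1 = begin
      (θ (i ℕ.+ k) -ₚ θ i) *ₚ Fr^ i (E k)               ≈⟨ B.*-congʳ {Fr^ i (E k)} (B.+-cong (Fr^-θ i k) (B.-‿cong Fr^iθ0≈θi)) ⟨
      (Fr^ i (θ k) -ₚ Fr^ i (θ 0)) *ₚ Fr^ i (E k)       ≈⟨ B.*-congʳ {Fr^ i (E k)} (Fr^-minus i (θ k) (θ 0)) ⟨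
      Fr^ i (θ k -ₚ θ 0) *ₚ Fr^ i (E k)                 ≈⟨ Fr^-* i (θ k -ₚ θ 0) (E k) ⟨
      Fr^ i ((θ k -ₚ θ 0) *ₚ E k)                       ≈⟨ Fr^-cong i ([θk-θ0]*Ek≈1 1≤k k≤d-1) ⟩
      Fr^ i oneₚ                                        ≈⟨ Fr^-oneₚ i ⟩
      oneₚ                                              ∎
      where
      Fr^iθ0≈θi : Fr^ i (θ 0) ≈ₕ θ i
      Fr^iθ0≈θi = ≡.subst (λ m → Fr^ i (θ 0) ≈ₕ θ m) (ℕₚ.+-identityʳ i) (Fr^-θ i 0)

    -- For i < j, e i j is Frⁱ of the inverse (L_{d-1} / [j - i]) · (-c)⁻¹ of θ_{j-i} - θ₀.
    e : ℕ → ℕ → Pol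
    e i j with i ℕₚ.<? j
    ... | yes _ = Fr^ i (E (j ∸ i))
    ... | no  _ = -ₚ Fr^ j (E (i ∸ j))

    open Lagrange θ e

    [θj-θi]*Fr^iE[j-i]≈1 : ∀ {i j} → i < j → j < d → (θ j -ₚ θ i) *ₚ Fr^ i (E (j ∸ i)) ≈ₕ oneₚ
    [θj-θi]*Fr^iE[j-i]≈1 {i} {j} i<j j<d = ≡.subst (λ l → (θ l -ₚ θ i) *ₚ Fr^ i (E (j ∸ i)) ≈ₕ oneₚ) (ℕₚ.m+[n∸m]≡n (ℕₚ.<⇒≤ i<j))
        ([θ[i+k]-θi]*Fr^iEk≈1 i (ℕₚ.m<n⇒0<n∸m i<j) (ℕₚ.≤-trans (ℕₚ.m∸n≤m j i) (m<n⇒m≤n∸1 j<d)))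

    θ-inverts : ∀ {i j} → i < d → j < d → i ≢ j → Inverts i j
    θ-inverts {i} {j} i<d j<d i≢j with i ℕₚ.<? j
    ... | yes i<j = [θj-θi]*Fr^iE[j-i]≈1 i<j j<d
    ... | no  i≮j = begin
      (θ j -ₚ θ i) *ₚ (-ₚ Fr^ j (E (i ∸ j)))      ≈⟨ -‿distribʳ-* (θ j -ₚ θ i) _ ⟨
      -ₚ ((θ j -ₚ θ i) *ₚ Fr^ j (E (i ∸ j)))      ≈⟨ -‿distribˡ-* (θ j -ₚ θ i) _ ⟩
      (-ₚ (θ j -ₚ θ i)) *ₚ Fr^ j (E (i ∸ j))      ≈⟨ B.*-congʳ {Fr^ j (E (i ∸ j))} (⁻¹-anti-homo‿- (θ j) (θ i)) ⟩
      (θ i -ₚ θ j) *ₚ Fr^ j (E (i ∸ j))           ≈⟨ [θj-θi]*Fr^iE[j-i]≈1 (ℕₚ.≤∧≢⇒< (ℕₚ.≮⇒≥ i≮j) (i≢j ∘ ≡.sym)) i<d ⟩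
      oneₚ                                        ∎

    term≈[-c]⁻¹ : ∀ j → j < d → ∏ (e j) (range 0 j) *ₚ ∏ (e j) (range (suc j) (d ∸ suc j)) ≈ₕ [-c]⁻¹
    term≈[-c]⁻¹ j j<d = x*-c≈1⇒x≈[-c]⁻¹ (begin
      (Pbelow *ₚ Pabove) *ₚ const (- c)        ≈⟨ B.*-congˡ {Pbelow *ₚ Pabove} (D≈-c j) ⟨
      (Pbelow *ₚ Pabove) *ₚ D j                ≈⟨ B.*-congˡ {Pbelow *ₚ Pabove} (D-split j<d) ⟩
      (Pbelow *ₚ Pabove) *ₚ (Dbelow *ₚ Dabove) ≈⟨ interchange Pbelow Pabove Dbelow Dabove ⟩
      (Pbelow *ₚ Dbelow) *ₚ (Pabove *ₚ Dabove) ≈⟨ B.*-cong (∏-Inverts below) (∏-Inverts above) ⟩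
      oneₚ *ₚ oneₚ                             ≈⟨ B.*-identityˡ oneₚ ⟩
      oneₚ                                     ∎)
      where
      open import Algebra.Properties.CommutativeSemigroup B.*-commutativeSemigroup using (interchange)
      Pbelow = ∏ (e j) (range 0 j)
      Pabove = ∏ (e j) (range (suc j) (d ∸ suc j))
      Dbelow = ∏ (δ j) (range 0 j)
      Dabove = ∏ (δ j) (range (suc j) (d ∸ suc j))
      below : All (Inverts j) (range 0 j)
      below = All-range 0 j λ k _ k<j → θ-inverts j<d (ℕₚ.<-trans k<j j<d) (ℕₚ.<⇒≢ k<j ∘ ≡.sym)
      above : All (Inverts j) (range (suc j) (d ∸ suc j))
      above = All-range (suc j) (d ∸ suc j) λ k j<k k<d →
        θ-inverts j<d (≡.subst (k <_) (ℕₚ.m+[n∸m]≡n j<d) k<d) (ℕₚ.<⇒≢ j<k)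

    Σ : Pol
    Σ = lagrangeSum (λ _ → oneₚ) (range 0 d)

    Σ≈d×[-c]⁻¹ : Σ ≈ₕ d ×ₕ [-c]⁻¹
    Σ≈d×[-c]⁻¹ = lagrangeSum-range [-c]⁻¹ d d 0 ≡.refl (λ j _ j<d → term≈[-c]⁻¹ j j<d)

    Σ≈0 : Σ ≈ₕ []
    Σ≈0 = ≡.subst (λ l → lagrangeSum (λ _ → oneₚ) l ≈ₕ []) (≡.sym (range-≥2 0 1<d))
      (lagrangeSum≈0 0 1 (range 2 (d ∸ 2))
        (≡.subst (AllPairs Inverts) (range-≥2 0 1<d)
          (AllPairs-range d (λ i j i<j j<d → θ-inverts (ℕₚ.<-trans i<j j<d) j<d (ℕₚ.<⇒≢ i<j))))
        (≡.subst (AllPairs (flip Inverts)) (range-≥2 0 1<d)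
          (AllPairs-range d (λ i j i<j j<d → θ-inverts j<d (ℕₚ.<-trans i<j j<d) (ℕₚ.<⇒≢ i<j ∘ ≡.sym)))))

    d×1≈0 : ntimes d 1# ≈ 0#
    d×1≈0 = const≈ₕ0⇒≈0 (begin
      const (ntimes d 1#)              ≈⟨ ×ₕ-oneₚ d ⟨
      d ×ₕ oneₚ                        ≈⟨ ×-congʳ d -c*[-c]⁻¹≈1 ⟨
      d ×ₕ (const (- c) *ₚ [-c]⁻¹)     ≈⟨ ×-comm-* d (const (- c)) [-c]⁻¹ ⟨
      const (- c) *ₚ (d ×ₕ [-c]⁻¹)     ≈⟨ B.*-congˡ {const (- c)} (B.trans (B.sym Σ≈d×[-c]⁻¹) Σ≈0) ⟩
      const (- c) *ₚ []                ≈⟨ B.zeroʳ (const (- c)) ⟩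
      []                               ∎)

prime∤⇒coprime : ∀ {p n} → Prime p → ¬ p ∣ n → Coprime p n
prime∤⇒coprime p-prime p∤n (i∣p , i∣n) with prime⇒irreducible p-prime i∣p
... | inj₁ i≡1    = i≡1
... | inj₂ ≡.refl = contradiction i∣n p∤n

module Characteristic (F : CommutativeRing 0ℓ 0ℓ) where
  open CommutativeRing F
  open Poly F using (ntimes)
  open import Algebra.Properties.Semiring.Mult semiring using (_×_; ×-homo-1; ×-homo-+; ×1-homo-*)

  ntimes≡× : ∀ n x → ntimes n x ≡ n × x
  ntimes≡× zero    x = ≡.refl
  ntimes≡× (suc n) x = ≡.cong (x +_) (ntimes≡× n x)

  _·1 : ℕ → Carrier
  n ·1 = n × 1#

  ·1≈0⇒*·1≈0 : ∀ m {n} → n ·1 ≈ 0# → (m ℕ.* n) ·1 ≈ 0#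
  ·1≈0⇒*·1≈0 m {n} n·1≈0 = trans (×1-homo-* m n) (trans (*-congˡ n·1≈0) (zeroʳ _))

  1+a≡b⇒1≈0 : ∀ {a b} → a ·1 ≈ 0# → b ·1 ≈ 0# → 1 ℕ.+ a ≡ b → 1# ≈ 0#
  1+a≡b⇒1≈0 {a} {b} a·1≈0 b·1≈0 1+a≡b = begin
    1#              ≈⟨ ×-homo-1 1# ⟨
    1 ·1            ≈⟨ +-identityʳ (1 ·1) ⟨
    1 ·1 + 0#       ≈⟨ +-congˡ a·1≈0 ⟨
    1 ·1 + a ·1     ≈⟨ ×-homo-+ 1# 1 a ⟨
    (1 ℕ.+ a) ·1    ≡⟨ ≡.cong _·1 1+a≡b ⟩
    b ·1            ≈⟨ b·1≈0 ⟩
    0#              ∎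
    where open import Relation.Binary.Reasoning.Setoid setoid

  ·1≈0⇒p∣n : ∀ {p} → Prime p → ¬ 1# ≈ 0# → p ·1 ≈ 0# → ∀ {n} → n ·1 ≈ 0# → p ∣ n
  ·1≈0⇒p∣n {p} p-prime 1≉0 p·1≈0 {n} n·1≈0 with p ∣? n
  ... | yes p∣n = p∣n
  ... | no  p∤n with coprime-Bézout (prime∤⇒coprime p-prime p∤n)
  ... | Bézout.+- x y 1+yn≡xp = contradiction (1+a≡b⇒1≈0 (·1≈0⇒*·1≈0 y n·1≈0) (·1≈0⇒*·1≈0 x p·1≈0) 1+yn≡xp) 1≉0
  ... | Bézout.-+ x y 1+xp≡yn = contradiction (1+a≡b⇒1≈0 (·1≈0⇒*·1≈0 x p·1≈0) (·1≈0⇒*·1≈0 y n·1≈0) 1+xp≡yn) 1≉0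

  prime-characteristic∣ : ¬ 1# ≈ 0# → ∀ {p} → Prime p → ntimes p 1# ≈ 0# → ∀ {n} → ntimes n 1# ≈ 0# → p ∣ n
  prime-characteristic∣ 1≉0 {p} p-prime p×1≈0 {n} n×1≈0 =
    ·1≈0⇒p∣n p-prime 1≉0 (≡.subst (_≈ 0#) (ntimes≡× p 1#) p×1≈0) (≡.subst (_≈ 0#) (ntimes≡× n 1#) n×1≈0)

theorem6 : (R : CommutativeRing 0ℓ 0ℓ) (q p : ℕ) →
    IsFiniteField R q → Prime p → (∃ λ k → q ≡ p ^ k) →
    CommutativeRing._≈_ R (Poly.ntimes R p (CommutativeRing.1# R)) (CommutativeRing.0# R) →
    (d : ℕ) → 1 < d → (c : CommutativeRing.Carrier R) → ¬ CommutativeRing._≈_ R c (CommutativeRing.0# R) →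
    Poly.NontrivialGcd R (Poly._+ₚ_ R (Poly.L R q (d ∸ 1)) (Poly.const R c)) (Poly.bracket R q d) →
    p ∣ d
theorem6 R q p isFiniteField p-prime (k , q≡p^k) p×1≈0 d 1<d c c≉0 (h , h∣L+c , h∣[d] , h-nonunit) =
  prime-characteristic∣ (IsFiniteField.1≉0 isFiniteField) p-prime p×1≈0
    (Periodic.d×1≈0 1<d (h∣[n]⇒θn≈θ0 {d} h∣[d]) c≉0 (h∣L+c⇒L≈-c {d ∸ 1} h∣L+c))
  where
  open Characteristic R using (prime-characteristic∣)
  open Modulo R isFiniteField p-prime {k} q≡p^k p×1≈0 h h-nonunit
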